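{- Let $G$ be a pair of $d$-dimensional butterflies and let $0\le m\le d$. For every set $A$ of input nodes and every set $B$ of output nodes of $G$ with $|A|=|B|=2^{d}-2^{m}$, there exist node-disjoint paths from $A$ to $B$.
   Context: The standard $d$-dimensional butterfly is the directed graph whose nodes are the pairs $(i,b)$ with $i\in\{0,\dots,d\}$ (the layer) and $b\in\{0,1\}^d$ (the label). For $1\le i\le d$ there is a directed edge from $(i-1,b)$ to each of the two nodes $(i,b')$ where $b'$ agrees with $b$ except possibly in coordinate $i$. Layer-$0$ nodes are inputs and layer-$d$ nodes are outputs. A pair of $d$-dimensional butterflies is formed from two directed graphs $G_1$ and $G_2$, each isomorphic to the standard $d$-dimensional butterfly (not necessarily identical to each other). The output nodes of $G_1$ are identified with the input nodes of $G_2$ via a bijection. The result has layers $0,\dots,2d$; its inputs are the inputs of $G_1$ and its outputs are the outputs of $G_2$. For a set $A$ of inputs and a set $B$ of outputs with $|A|=|B|$, "node-disjoint paths from $A$ to $B$" means $|A|$ directed paths, each from a node of $A$ to a node of $B$, no two sharing a node and none repeating a node. Hence each node of $A\cup B$ is an endpoint of exactly one path. -}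

module Defs where

open import Data.Nat using (ℕ; zero; suc)
open import Data.Fin using (Fin; toℕ; fromℕ)
open import Data.Bool using (Bool)
open import Data.Vec using (Vec; lookup)
open import Data.Product using (Σ; _×_; _,_; proj₁; proj₂)
open import Data.Sum using (_⊎_; inj₁; inj₂)
open import Data.Empty using (⊥)
open import Data.List using (List; []; _∷_; map; concatMap)
open import Data.Nat using (_<_)
open import Relation.Nullary using (¬_)
open import Relation.Binary.PropositionalEquality using (_≡_)
open import Function.Bundles using (_↔_; _⇔_; Inverse)

record Digraph : Set₁ where
  field
    Node : Set
    Edge : Node → Node → Set

open Digraph public

-- Coordinate j (1-indexed, 1 ≤ j ≤ d) of the paper is the Vec index j-1.
-- Edge (i-1,b) → (i,b') iff b, b' agree except possibly in coordinate i,
-- i.e. except possibly at Vec index i-1 = toℕ (source layer).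

SBNode : ℕ → Set
SBNode d = Fin (suc d) × Vec Bool d

SBEdge : (d : ℕ) → SBNode d → SBNode d → Set
SBEdge d (i , b) (j , b') =
  (toℕ j ≡ suc (toℕ i)) ×
  ((k : Fin d) → ¬ (toℕ k ≡ toℕ i) → lookup b k ≡ lookup b' k)

Butterfly : ℕ → Digraph
Butterfly d = record { Node = SBNode d ; Edge = SBEdge d }

record IsoToButterfly (d : ℕ) (G : Digraph) : Set where
  field
    iso      : Node G ↔ SBNode d
    preserve : (u v : Node G) →
               Edge G u v ⇔ SBEdge d (Inverse.to iso u) (Inverse.to iso v)

  layer : Node G → Fin (suc d)
  layer u = proj₁ (Inverse.to iso u)

  IsIn : Node G → Set
  IsIn u = layer u ≡ Data.Fin.zero

  IsOut : Node G → Set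
  IsOut u = layer u ≡ fromℕ d

record PairOfButterflies (d : ℕ) : Set₁ where
  field
    G₁ G₂ : Digraph
    φ₁    : IsoToButterfly d G₁
    φ₂    : IsoToButterfly d G₂
    glue  : Σ (Node G₁) (IsoToButterfly.IsOut φ₁) ↔
            Σ (Node G₂) (IsoToButterfly.IsIn φ₂)

  module Φ₁ = IsoToButterfly φ₁
  module Φ₂ = IsoToButterfly φ₂

  glueTo : (u : Node G₁) → Φ₁.IsOut u → Node G₂
  glueTo u o = proj₁ (Inverse.to glue (u , o))

  -- Nodes of the glued graph: all nodes of G₁, plus the non-input nodes of
  -- G₂ (each input of G₂ is identified with an output of G₁).
  GNode : Set
  GNode = Node G₁ ⊎ Σ (Node G₂) (λ v → 0 < toℕ (Φ₂.layer v))

  GEdge : GNode → GNode → Set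
  GEdge (inj₁ u) (inj₁ u') = Edge G₁ u u'
  GEdge (inj₁ u) (inj₂ v)  = Σ (Φ₁.IsOut u) (λ o → Edge G₂ (glueTo u o) (proj₁ v))
  GEdge (inj₂ v) (inj₁ u)  = ⊥
  GEdge (inj₂ v) (inj₂ v') = Edge G₂ (proj₁ v) (proj₁ v')

  graph : Digraph
  graph = record { Node = GNode ; Edge = GEdge }

  IsInput : GNode → Set
  IsInput (inj₁ u) = Φ₁.IsIn u
  IsInput (inj₂ v) = ⊥

  -- Outputs of the pair = outputs of G₂ (an output of G₂ may be an input of
  -- G₂, hence a glued node of G₁, only when d = 0).
  IsOutput : GNode → Set
  IsOutput (inj₁ u) = Σ (Φ₁.IsOut u) (λ o → Φ₂.IsOut (glueTo u o))
  IsOutput (inj₂ v) = Φ₂.IsOut (proj₁ v)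

data Walk (G : Digraph) : Node G → Node G → Set where
  here : (x : Node G) → Walk G x x
  step : {x y z : Node G} → Edge G x y → Walk G y z → Walk G x z

walkNodes : {G : Digraph} {x y : Node G} → Walk G x y → List (Node G)
walkNodes (here x)     = x ∷ []
walkNodes {x = x} (step e w) = x ∷ walkNodes w

AnyWalk : Digraph → Set
AnyWalk G = Σ (Node G) (λ a → Σ (Node G) (λ b → Walk G a b))

start : {G : Digraph} → AnyWalk G → Node G
start (a , _ , _) = a

end : {G : Digraph} → AnyWalk G → Node G
end (_ , b , _) = b

nodesOf : {G : Digraph} → AnyWalk G → List (Node G)
nodesOf (_ , _ , w) = walkNodes w

module Submission where

-- In one d-dimensional butterfly, any 2^d − 2^m inputs can be routed along node-disjoint paths onto
-- exactly the outputs outside a set meeting every class of outputs with the same first m bits once: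
-- split on the first coordinate, send the two inputs of a pair into different halves, share out the
-- lone inputs evenly, and recurse. Some such set of outputs of G₁ is glued to a set of inputs of G₂
-- with the same property in the reversed coordinates of G₂: start from all outputs and halve d − m
-- times, keeping one colour class of a proper 2-colouring of two perfect matchings. Routing A forward
-- through G₁ and B backward through G₂ onto the complement of this set, the two families of paths meet
-- in the glued layer and concatenate to node-disjoint paths from A to B.

open import Defs
open import Data.Nat using (ℕ; zero; suc; z≤n; _≤_; _^_; _∸_)
open import Data.List using (List; []; length; map; concatMap)
open import Data.List.Relation.Unary.All using (All; [])
open import Data.List.Relation.Unary.AllPairs using ([])
open import Data.List.Relation.Unary.Unique.Propositional using (Unique)
open import Data.List.Relation.Binary.Permutation.Propositional using (_↭_; ↭-refl)
open import Data.Product using (Σ; _×_; _,_)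
open import Relation.Binary.PropositionalEquality using (_≡_)

module Cube where

  open import Data.Nat using (ℕ; zero; suc; _+_; _*_; _∸_; _^_; _≤_; _⊓_; z≤n; s≤s)
  open import Data.Nat.Properties
  open import Data.Bool using (Bool; true; false; not; _∧_)
  open import Data.Bool.Properties using (∧-zeroʳ; ∧-identityʳ)
  open import Data.Vec using (Vec; []; _∷_)
  open import Data.Vec.Properties using (≡-dec)
  import Data.Bool.Properties as Bool
  open import Data.List using (List; []; _∷_; length)
  open import Data.List.Membership.Propositional using (_∈_)
  import Data.List.Membership.DecPropositional as DecMembership
  open import Data.List.Relation.Unary.AllPairs using (_∷_)
  open import Data.List.Relation.Unary.Unique.Propositional using (Unique)
  open import Data.List.Relation.Unary.Unique.Propositional.Properties using (Unique[x∷xs]⇒x∉xs)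
  open import Relation.Nullary using (does; yes; no; contradiction)
  open import Relation.Nullary.Decidable using (dec-true; dec-false)
  open import Relation.Binary.Definitions using (DecidableEquality)
  open import Data.Product using (∃-syntax; _×_; _,_)
  open import Data.Empty using (⊥-elim)
  open import Function using (_∘_)
  open import Relation.Binary.PropositionalEquality
  open import Algebra.Properties.CommutativeSemigroup +-commutativeSemigroup using (interchange)

  Bits : ℕ → Set
  Bits n = Vec Bool n

  _⊆ᵇ_ : ∀ {n} → (Bits n → Bool) → (Bits n → Bool) → Set
  p ⊆ᵇ q = ∀ s → p s ≡ true → q s ≡ true

  bit : Bool → ℕ
  bit false = 0
  bit true  = 1

  bit≤1 : ∀ b → bit b ≤ 1
  bit≤1 false = z≤n
  bit≤1 true  = s≤s z≤n

  sumBits : ∀ n → (Bits n → ℕ) → ℕ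
  sumBits zero    f = f []
  sumBits (suc n) f = sumBits n (f ∘ (false ∷_)) + sumBits n (f ∘ (true ∷_))

  count : ∀ {n} → (Bits n → Bool) → ℕ
  count {n} χ = sumBits n (bit ∘ χ)

  sumBits-cong : ∀ n {f g : Bits n → ℕ} → (∀ s → f s ≡ g s) → sumBits n f ≡ sumBits n g
  sumBits-cong zero    f≗g = f≗g []
  sumBits-cong (suc n) f≗g =
    cong₂ _+_ (sumBits-cong n (f≗g ∘ (false ∷_))) (sumBits-cong n (f≗g ∘ (true ∷_)))

  sumBits-+ : ∀ n (f g : Bits n → ℕ) → sumBits n (λ s → f s + g s) ≡ sumBits n f + sumBits n g
  sumBits-+ zero    f g = refl
  sumBits-+ (suc n) f g = begin
    sumBits n (λ s → f₀ s + g₀ s) + sumBits n (λ s → f₁ s + g₁ s)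
      ≡⟨ cong₂ _+_ (sumBits-+ n f₀ g₀) (sumBits-+ n f₁ g₁) ⟩
    (sumBits n f₀ + sumBits n g₀) + (sumBits n f₁ + sumBits n g₁)
      ≡⟨ interchange (sumBits n f₀) (sumBits n g₀) (sumBits n f₁) (sumBits n g₁) ⟩
    (sumBits n f₀ + sumBits n f₁) + (sumBits n g₀ + sumBits n g₁) ∎
    where
    open ≡-Reasoning
    f₀ = f ∘ (false ∷_)
    f₁ = f ∘ (true ∷_)
    g₀ = g ∘ (false ∷_)
    g₁ = g ∘ (true ∷_)

  sumBits-mono : ∀ n {f g : Bits n → ℕ} → (∀ s → f s ≤ g s) → sumBits n f ≤ sumBits n g
  sumBits-mono zero    f≤g = f≤g []
  sumBits-mono (suc n) f≤g =
    +-mono-≤ (sumBits-mono n (f≤g ∘ (false ∷_))) (sumBits-mono n (f≤g ∘ (true ∷_)))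

  sumBits-const : ∀ n c → sumBits n (λ _ → c) ≡ 2 ^ n * c
  sumBits-const zero    c = sym (+-identityʳ c)
  sumBits-const (suc n) c = begin
    sumBits n (λ _ → c) + sumBits n (λ _ → c) ≡⟨ cong₂ _+_ (sumBits-const n c) (sumBits-const n c) ⟩
    2 ^ n * c + 2 ^ n * c                     ≡⟨ sym (*-distribʳ-+ c (2 ^ n) (2 ^ n)) ⟩
    (2 ^ n + 2 ^ n) * c                       ≡⟨ cong (λ k → (2 ^ n + k) * c) (sym (+-identityʳ (2 ^ n))) ⟩
    2 ^ suc n * c                             ∎
    where open ≡-Reasoning

  count-none : ∀ n → count {n} (λ _ → false) ≡ 0
  count-none n = trans (sumBits-const n 0) (*-zeroʳ (2 ^ n))

  count≤2^n : ∀ {n} (χ : Bits n → Bool) → count χ ≤ 2 ^ n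
  count≤2^n {n} χ = begin
    count χ              ≤⟨ sumBits-mono n (bit≤1 ∘ χ) ⟩
    sumBits n (λ _ → 1)  ≡⟨ sumBits-const n 1 ⟩
    2 ^ n * 1            ≡⟨ *-identityʳ (2 ^ n) ⟩
    2 ^ n                ∎
    where open ≤-Reasoning

  count-mono : ∀ {n} {p q : Bits n → Bool} → p ⊆ᵇ q → count p ≤ count q
  count-mono {n} {p} {q} p⊆q = sumBits-mono n bit-mono
    where
    bit-mono : ∀ s → bit (p s) ≤ bit (q s)
    bit-mono s with p s in ps
    ... | false = z≤n
    ... | true  rewrite p⊆q s ps = ≤-refl

  count-pointwise : ∀ {n} (p q r s : Bits n → Bool) →
    (∀ t → bit (p t) + bit (q t) ≡ bit (r t) + bit (s t)) →
    count p + count q ≡ count r + count s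
  count-pointwise {n} p q r s eq = begin
    count p + count q                      ≡⟨ sym (sumBits-+ n (bit ∘ p) (bit ∘ q)) ⟩
    sumBits n (λ t → bit (p t) + bit (q t)) ≡⟨ sumBits-cong n eq ⟩
    sumBits n (λ t → bit (r t) + bit (s t)) ≡⟨ sumBits-+ n (bit ∘ r) (bit ∘ s) ⟩
    count r + count s                      ∎
    where open ≡-Reasoning

  private
    ≤-+-≡-double : ∀ {a b N} → a ≤ N → b ≤ N → a + b ≡ N + N → a ≡ N
    ≤-+-≡-double {a} {b} {N} a≤N b≤N eq = ≤-antisym a≤N (+-cancelʳ-≤ N N a (begin
      N + N ≡⟨ sym eq ⟩
      a + b ≤⟨ +-monoʳ-≤ a b≤N ⟩
      a + N ∎))
      where open ≤-Reasoning

  count-full : ∀ {n} (χ : Bits n → Bool) → count χ ≡ 2 ^ n → ∀ s → χ s ≡ true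
  count-full {zero} χ eq [] with χ [] | eq
  ... | true | _ = refl
  count-full {suc n} χ eq (x ∷ s) = count-full (χ ∘ (x ∷_)) (half x) s
    where
    χ₀ = χ ∘ (false ∷_)
    χ₁ = χ ∘ (true ∷_)
    full : count χ₀ + count χ₁ ≡ 2 ^ n + 2 ^ n
    full = trans eq (cong (2 ^ n +_) (+-identityʳ (2 ^ n)))
    half : ∀ x → count (χ ∘ (x ∷_)) ≡ 2 ^ n
    half false = ≤-+-≡-double (count≤2^n χ₀) (count≤2^n χ₁) full
    half true  = ≤-+-≡-double (count≤2^n χ₁) (count≤2^n χ₀) (trans (+-comm (count χ₁) (count χ₀)) full)

  choose : ∀ {n} (σ : Bits n → Bool) k → k ≤ count σ → ∃[ τ ] τ ⊆ᵇ σ × count τ ≡ k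
  choose {zero} σ zero          _ = (λ _ → false) , (λ _ ()) , refl
  choose {zero} σ (suc zero)    h = σ , (λ _ e → e) , ≤-antisym (bit≤1 (σ [])) h
  choose {zero} σ (suc (suc k)) h = ⊥-elim (<⇒≱ (s≤s (s≤s z≤n)) (≤-trans h (bit≤1 (σ []))))
  choose {suc n} σ k h with choose (σ ∘ (false ∷_)) (c₀ ⊓ k) (m⊓n≤m c₀ k)
                          | choose (σ ∘ (true ∷_)) (k ∸ c₀) (m≤n+o⇒m∸n≤o k c₀ h)
    where c₀ = count (σ ∘ (false ∷_))
  ... | τ₀ , τ₀⊆ , #τ₀ | τ₁ , τ₁⊆ , #τ₁ =
    τ , τ⊆σ , trans (cong₂ _+_ #τ₀ #τ₁) (m⊓n+n∸m≡n (count (σ ∘ (false ∷_))) k)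
    where
    τ : Bits (suc n) → Bool
    τ (false ∷ t) = τ₀ t
    τ (true  ∷ t) = τ₁ t
    τ⊆σ : τ ⊆ᵇ σ
    τ⊆σ (false ∷ t) = τ₀⊆ t
    τ⊆σ (true  ∷ t) = τ₁⊆ t

  count-∧-⊆ : ∀ {n} {p q : Bits n → Bool} → q ⊆ᵇ p → count (λ t → p t ∧ q t) ≡ count q
  count-∧-⊆ {n} {p} {q} q⊆p = sumBits-cong n pointwise
    where
    pointwise : ∀ t → bit (p t ∧ q t) ≡ bit (q t)
    pointwise t with q t in qt
    ... | false = cong bit (∧-zeroʳ (p t))
    ... | true  rewrite q⊆p t qt = refl

  count-∧-not-⊆ : ∀ {n} {p q : Bits n → Bool} → q ⊆ᵇ p → count (λ t → p t ∧ not (q t)) + count q ≡ count p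
  count-∧-not-⊆ {n} {p} {q} q⊆p = trans (sym (sumBits-+ n _ (bit ∘ q))) (sumBits-cong n pointwise)
    where
    pointwise : ∀ t → bit (p t ∧ not (q t)) + bit (q t) ≡ bit (p t)
    pointwise t with q t in qt
    ... | true  rewrite q⊆p t qt = refl
    ... | false = trans (+-identityʳ _) (cong bit (∧-identityʳ (p t)))

  _≟ᴮ_ : ∀ {n} → DecidableEquality (Bits n)
  _≟ᴮ_ = ≡-dec Bool._≟_

  _∈ᴮ_ : ∀ {n} → Bits n → List (Bits n) → Bool
  s ∈ᴮ xs = does (DecMembership._∈?_ _≟ᴮ_ s xs)

  ∈ᴮ⇒∈ : ∀ {n} {s : Bits n} {xs} → s ∈ᴮ xs ≡ true → s ∈ xs
  ∈ᴮ⇒∈ {s = s} {xs} eq with DecMembership._∈?_ _≟ᴮ_ s xs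
  ... | yes s∈xs = s∈xs
  ... | no _     = contradiction eq λ ()

  ∈⇒∈ᴮ : ∀ {n} {s : Bits n} {xs} → s ∈ xs → s ∈ᴮ xs ≡ true
  ∈⇒∈ᴮ {s = s} {xs} = dec-true (DecMembership._∈?_ _≟ᴮ_ s xs)

  count-≟ᴮ : ∀ {n} (x : Bits n) → count (λ s → does (s ≟ᴮ x)) ≡ 1
  count-≟ᴮ []                = refl
  count-≟ᴮ {suc n} (false ∷ x) = cong₂ _+_ (count-≟ᴮ x) (count-none n)
  count-≟ᴮ {suc n} (true  ∷ x) = cong₂ _+_ (count-none n) (count-≟ᴮ x)

  count-∈ᴮ : ∀ {n} {xs : List (Bits n)} → Unique xs → count (_∈ᴮ xs) ≡ length xs
  count-∈ᴮ {n} {[]}     _ = count-none n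
  count-∈ᴮ {n} {x ∷ xs} unique@(_ ∷ unique-xs) =
    trans (sumBits-cong n pointwise) (trans (sumBits-+ n _ _) (cong₂ _+_ (count-≟ᴮ x) (count-∈ᴮ unique-xs)))
    where
    pointwise : ∀ s → bit (s ∈ᴮ (x ∷ xs)) ≡ bit (does (s ≟ᴮ x)) + bit (s ∈ᴮ xs)
    pointwise s with s ≟ᴮ x
    ... | no _     = refl
    ... | yes refl rewrite dec-false (DecMembership._∈?_ _≟ᴮ_ s xs) (Unique[x∷xs]⇒x∉xs unique) = refl

module SingleButterfly where

  open import Data.Nat using (ℕ; zero; suc; _+_; _*_; _∸_; _^_; _≤_; _<_; s≤s; s≤s⁻¹)
  open import Data.Nat.Properties
  open import Data.Nat.Solver using (module +-*-Solver)
  open import Data.Bool using (Bool; true; false; not; _∧_; _∨_; _xor_; if_then_else_)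
  open import Data.Bool.Properties using (¬-not)
  import Data.Bool.Properties as Bool
  open import Data.Fin using (Fin; toℕ; opposite) renaming (zero to fzero; suc to fsuc)
  open import Data.Fin.Properties using (opposite-prop; opposite-involutive; toℕ<n)
  open import Data.Vec using ([]; _∷_; tail; lookup; tabulate)
  open import Data.Vec.Properties using (∷-injectiveˡ; ∷-injectiveʳ; lookup∘tabulate; tabulate∘lookup; tabulate-cong)
  open import Data.Product using (∃-syntax; _×_; _,_; proj₁; proj₂)
  open import Data.Empty using (⊥-elim)
  open import Function using (_∘_; id)
  open import Relation.Nullary using (¬_; yes; no; contradiction)
  open import Relation.Unary using (∅; _≐_)
  open import Relation.Binary.PropositionalEquality
  open Cube

  -- The label at layer i of the butterfly path from input s to output t:
  -- the first i bits of t followed by the remaining bits of s.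
  splice : ∀ {n} → ℕ → Bits n → Bits n → Bits n
  splice zero    t       s       = s
  splice (suc i) []      []      = []
  splice (suc i) (x ∷ t) (_ ∷ s) = x ∷ splice i t s

  splice-self : ∀ {n} i (s : Bits n) → splice i s s ≡ s
  splice-self zero    s       = refl
  splice-self (suc i) []      = refl
  splice-self (suc i) (x ∷ s) = cong (x ∷_) (splice-self i s)

  splice-all : ∀ {n} (t s : Bits n) → splice n t s ≡ t
  splice-all []      []      = refl
  splice-all (x ∷ t) (_ ∷ s) = cong (x ∷_) (splice-all t s)

  DisjointRoutes : ∀ {n} → (Bits n → Bool) → (Bits n → Bits n) → Set
  DisjointRoutes χ f =
    ∀ i {s s'} → χ s ≡ true → χ s' ≡ true → splice i (f s) s ≡ splice i (f s') s' → s ≡ s'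

  record Routing {n} (χ : Bits n → Bool) (C : Bits n → Set) : Set where
    field
      target   : Bits n → Bits n
      disjoint : DisjointRoutes χ target
      avoids   : ∀ {s} → χ s ≡ true → ¬ C (target s)
      onto     : ∀ {y} → ¬ C y → ∃[ s ] χ s ≡ true × target s ≡ y

  Routing-resp : ∀ {n} {χ : Bits n → Bool} {C C' : Bits n → Set} → C ≐ C' → Routing χ C → Routing χ C'
  Routing-resp (C⊆C' , C'⊆C) R = record
    { target   = target
    ; disjoint = disjoint
    ; avoids   = λ χs → avoids χs ∘ C'⊆C
    ; onto     = λ ¬C'y → onto (¬C'y ∘ C⊆C')
    }
    where open Routing R

  identity-routing : ∀ {n} {χ : Bits n → Bool} → (∀ s → χ s ≡ true) → Routing χ ∅
  identity-routing full = record
    { target   = id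
    ; disjoint = λ i {s} {s'} _ _ eq → trans (sym (splice-self i s)) (trans eq (splice-self i s'))
    ; avoids   = λ _ ()
    ; onto     = λ {y} _ → y , full y , refl
    }

  -- The first layer of a routing, where a and b say whether false ∷ t and true ∷ t are inputs: the
  -- input x ∷ t moves to t in the half firstBitᵇ a b s x, so two inputs keep their own halves and a lone
  -- one goes to the half s; entersᵇ h a b s says that t is reached in the half h.
  private
    pick : Bool → Bool → Bool → Bool
    pick false a b = a
    pick true  a b = b

    agree : Bool → Bool → Bool
    agree s true  = s
    agree s false = not s

    firstBitᵇ : (a b s x : Bool) → Bool
    firstBitᵇ a b s x = if a ∧ b then x else s

    entersᵇ : (h a b s : Bool) → Bool
    entersᵇ h a b s = (a ∧ b) ∨ ((a xor b) ∧ agree s h)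

    entersᵇ-firstBitᵇ : ∀ a b s x → pick x a b ≡ true → entersᵇ (firstBitᵇ a b s x) a b s ≡ true
    entersᵇ-firstBitᵇ true  true  s     false _ = refl
    entersᵇ-firstBitᵇ true  true  s     true  _ = refl
    entersᵇ-firstBitᵇ true  false false false _ = refl
    entersᵇ-firstBitᵇ true  false true  false _ = refl
    entersᵇ-firstBitᵇ false true  false true  _ = refl
    entersᵇ-firstBitᵇ false true  true  true  _ = refl
    entersᵇ-firstBitᵇ false b     s     false ()
    entersᵇ-firstBitᵇ a     false s     true  ()

    firstBitᵇ-injective : ∀ a b s {x x'} → pick x a b ≡ true → pick x' a b ≡ true →
                          firstBitᵇ a b s x ≡ firstBitᵇ a b s x' → x ≡ x'
    firstBitᵇ-injective true  true  s                 _  _  eq = eq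
    firstBitᵇ-injective a     b     s {false} {false} _  _  _  = refl
    firstBitᵇ-injective a     b     s {true}  {true}  _  _  _  = refl
    firstBitᵇ-injective true  false s {false} {true}  _  () _
    firstBitᵇ-injective false b     s {false} {true}  () _  _
    firstBitᵇ-injective true  false s {true}  {false} () _  _
    firstBitᵇ-injective false b     s {true}  {false} _  () _

    entersᵇ-source : ∀ h a b s → entersᵇ h a b s ≡ true → ∃[ x ] pick x a b ≡ true × firstBitᵇ a b s x ≡ h
    entersᵇ-source false true  true  s     _ = false , refl , refl
    entersᵇ-source true  true  true  s     _ = true  , refl , refl
    entersᵇ-source true  true  false true  _ = false , refl , refl
    entersᵇ-source false true  false false _ = false , refl , refl
    entersᵇ-source true  false true  true  _ = true  , refl , refl
    entersᵇ-source false false true  false _ = true  , refl , refl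
    entersᵇ-source true  true  false false ()
    entersᵇ-source false true  false true  ()
    entersᵇ-source true  false true  false ()
    entersᵇ-source false false true  true  ()
    entersᵇ-source h     false false s     ()

    bit-entersᵇ : ∀ h a b s → bit (entersᵇ h a b s) ≡ bit (a ∧ b) + bit ((a xor b) ∧ agree s h)
    bit-entersᵇ h true  true  s = refl
    bit-entersᵇ h true  false s = refl
    bit-entersᵇ h false true  s = refl
    bit-entersᵇ h false false s = refl

    entersᵇ-toward : ∀ h a b → entersᵇ h a b h ≡ a ∨ b
    entersᵇ-toward false true  true  = refl
    entersᵇ-toward false true  false = refl
    entersᵇ-toward false false true  = refl
    entersᵇ-toward false false false = refl
    entersᵇ-toward true  true  true  = refl
    entersᵇ-toward true  true  false = refl
    entersᵇ-toward true  false true  = refl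
    entersᵇ-toward true  false false = refl

    entersᵇ-away : ∀ h a b → entersᵇ h a b (not h) ≡ a ∧ b
    entersᵇ-away false true  true  = refl
    entersᵇ-away false true  false = refl
    entersᵇ-away false false true  = refl
    entersᵇ-away false false false = refl
    entersᵇ-away true  true  true  = refl
    entersᵇ-away true  true  false = refl
    entersᵇ-away true  false true  = refl
    entersᵇ-away true  false false = refl

  both one some : ∀ {n} → (Bits (suc n) → Bool) → Bits n → Bool
  both χ t = χ (false ∷ t) ∧ χ (true ∷ t)
  one  χ t = χ (false ∷ t) xor χ (true ∷ t)
  some χ t = χ (false ∷ t) ∨ χ (true ∷ t)

  module FirstLayer {n} (χ : Bits (suc n) → Bool) (side : Bits n → Bool) where

    firstBit : Bool → Bits n → Bool
    firstBit x t = firstBitᵇ (χ (false ∷ t)) (χ (true ∷ t)) (side t) x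

    enters : Bool → Bits n → Bool
    enters h t = entersᵇ h (χ (false ∷ t)) (χ (true ∷ t)) (side t)

    χ-pick : ∀ x t → χ (x ∷ t) ≡ pick x (χ (false ∷ t)) (χ (true ∷ t))
    χ-pick false t = refl
    χ-pick true  t = refl

    enters-firstBit : ∀ {x t} → χ (x ∷ t) ≡ true → enters (firstBit x t) t ≡ true
    enters-firstBit {x} {t} c = entersᵇ-firstBitᵇ _ _ (side t) x (trans (sym (χ-pick x t)) c)

    enters-away : ∀ {h t} → side t ≡ not h → enters h t ≡ both χ t
    enters-away {h} {t} eq =
      trans (cong (entersᵇ h (χ (false ∷ t)) (χ (true ∷ t))) eq) (entersᵇ-away h (χ (false ∷ t)) (χ (true ∷ t)))

    enters-toward : ∀ {h t} → side t ≡ h → enters h t ≡ some χ t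
    enters-toward {h} {t} eq =
      trans (cong (entersᵇ h (χ (false ∷ t)) (χ (true ∷ t))) eq) (entersᵇ-toward h (χ (false ∷ t)) (χ (true ∷ t)))

    count-enters : ∀ h → count (enters h) ≡ count (both χ) + count (λ t → one χ t ∧ agree (side t) h)
    count-enters h = trans (sumBits-cong n (λ t → bit-entersᵇ h (χ (false ∷ t)) (χ (true ∷ t)) (side t)))
                           (sumBits-+ n (bit ∘ both χ) (λ t → bit (one χ t ∧ agree (side t) h)))

    extend : {C : Bits (suc n) → Set} → (∀ h → Routing (enters h) (C ∘ (h ∷_))) → Routing χ C
    extend {C} R = record { target = target ; disjoint = disjoint ; avoids = avoids ; onto = onto }
      where
      module R h = Routing (R h)

      target : Bits (suc n) → Bits (suc n)
      target (x ∷ t) = firstBit x t ∷ R.target (firstBit x t) t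

      disjoint : DisjointRoutes χ target
      disjoint zero    _ _ eq = eq
      disjoint (suc i) {x ∷ t} {x' ∷ t'} c c' eq = same-tail (R.disjoint h i (enters-firstBit c) c'' tails)
        where
        h = firstBit x t
        h≡h' = ∷-injectiveˡ eq
        c'' : enters h t' ≡ true
        c'' = subst (λ k → enters k t' ≡ true) (sym h≡h') (enters-firstBit c')
        tails : splice i (R.target h t) t ≡ splice i (R.target h t') t'
        tails = trans (∷-injectiveʳ eq) (cong (λ k → splice i (R.target k t') t') (sym h≡h'))
        same-tail : t ≡ t' → x ∷ t ≡ x' ∷ t'
        same-tail refl = cong (_∷ t) (firstBitᵇ-injective _ _ (side t)
          (trans (sym (χ-pick x t)) c) (trans (sym (χ-pick x' t)) c') h≡h')

      avoids : ∀ {s} → χ s ≡ true → ¬ C (target s)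
      avoids {x ∷ t} c = R.avoids (firstBit x t) (enters-firstBit c)

      onto : ∀ {y} → ¬ C y → ∃[ s ] χ s ≡ true × target s ≡ y
      onto {h ∷ y} ¬Cy with R.onto h ¬Cy
      ... | t , et , refl with entersᵇ-source h (χ (false ∷ t)) (χ (true ∷ t)) (side t) et
      ...   | x , px , refl = x ∷ t , trans (χ-pick x t) px , refl

  private
    open +-*-Solver

    squeeze : ∀ {a b N} → a ≤ b → b ≤ N → a + b + 1 ≡ 2 * N → b ≡ N × a + 1 ≡ N
    squeeze {a} {b} {N} a≤b b≤N eq = b≡N , +-cancelʳ-≡ N (a + 1) N a+1+N≡N+N
      where
      2N<2[1+b] : 2 * N < 2 * suc b
      2N<2[1+b] = begin-strict
        2 * N           ≡⟨ sym eq ⟩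
        a + b + 1       ≤⟨ +-monoˡ-≤ 1 (+-monoˡ-≤ b a≤b) ⟩
        b + b + 1       <⟨ n<1+n _ ⟩
        suc (b + b + 1) ≡⟨ solve 1 (λ b → con 1 :+ (b :+ b :+ con 1) := con 2 :* (con 1 :+ b)) refl b ⟩
        2 * suc b       ∎
        where open ≤-Reasoning
      b≡N : b ≡ N
      b≡N = ≤-antisym b≤N (s≤s⁻¹ (*-cancelˡ-< 2 N (suc b) 2N<2[1+b]))
      a+1+N≡N+N : a + 1 + N ≡ N + N
      a+1+N≡N+N = begin
        a + 1 + N  ≡⟨ solve 2 (λ a N → a :+ con 1 :+ N := a :+ N :+ con 1) refl a N ⟩
        a + N + 1  ≡⟨ cong (λ k → a + k + 1) (sym b≡N) ⟩
        a + b + 1  ≡⟨ eq ⟩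
        2 * N      ≡⟨ solve 1 (λ N → con 2 :* N := N :+ N) refl N ⟩
        N + N      ∎
        where open ≡-Reasoning

    even-split : ∀ a b c → a + 2 * b ≡ 2 * c → ∃[ k ] a ≡ 2 * k × k + b ≡ c
    even-split a zero    c       eq = c , trans (sym (+-identityʳ a)) eq , +-identityʳ c
    even-split a (suc b) zero    eq = contradiction (m+n≡0⇒n≡0 a eq) λ ()
    even-split a (suc b) (suc c) eq with even-split a b c (+-cancelˡ-≡ 2 _ _ (begin
        2 + (a + 2 * b)  ≡⟨ solve 2 (λ a b → con 2 :+ (a :+ con 2 :* b) := a :+ con 2 :* (con 1 :+ b)) refl a b ⟩
        a + 2 * suc b    ≡⟨ eq ⟩
        2 * suc c        ≡⟨ solve 1 (λ c → con 2 :* (con 1 :+ c) := con 2 :+ con 2 :* c) refl c ⟩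
        2 + 2 * c        ∎))
      where open ≡-Reasoning
    ... | k , a≡2k , k+b≡c = k , a≡2k , trans (+-suc k b) (cong suc k+b≡c)

  nearly-full : ∀ {n} (χ : Bits (suc n) → Bool) → count χ + 1 ≡ 2 * 2 ^ n →
                count (both χ) + 1 ≡ 2 ^ n × (∀ t → some χ t ≡ true)
  nearly-full {n} χ eq = proj₂ counts , count-full (some χ) (proj₁ counts)
    where
    bit-pair : ∀ a b → bit a + bit b ≡ bit (a ∧ b) + bit (a ∨ b)
    bit-pair true  true  = refl
    bit-pair true  false = refl
    bit-pair false true  = refl
    bit-pair false false = refl
    both⊆some : both χ ⊆ᵇ some χ
    both⊆some t _ with χ (false ∷ t) | χ (true ∷ t)
    ... | true | true = refl
    pairs : count (both χ) + count (some χ) + 1 ≡ 2 * 2 ^ n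
    pairs = trans (cong (_+ 1) (sym (count-pointwise (χ ∘ (false ∷_)) (χ ∘ (true ∷_)) (both χ) (some χ)
                    (λ t → bit-pair (χ (false ∷ t)) (χ (true ∷ t)))))) eq
    counts = squeeze (count-mono both⊆some) (count≤2^n (some χ)) pairs

  -- Pairs enter both halves; the lone inputs are even in number, 2K, and are split K to each half.
  balanced-side : ∀ {n m} (χ : Bits (suc n) → Bool) → count χ + 2 * 2 ^ m ≡ 2 * 2 ^ n →
                  ∃[ side ] ∀ h → count (FirstLayer.enters χ side h) + 2 ^ m ≡ 2 ^ n
  balanced-side {n} {m} χ eq = σ , balanced
    where
    open +-*-Solver
    cb = count (both χ)
    co = count (one χ)

    pairs : count χ ≡ cb + (cb + co)
    pairs = begin
      count χ
        ≡⟨ sym (sumBits-+ n _ _) ⟩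
      sumBits n (λ t → bit (χ (false ∷ t)) + bit (χ (true ∷ t)))
        ≡⟨ sumBits-cong n (λ t → bit-pair (χ (false ∷ t)) (χ (true ∷ t))) ⟩
      sumBits n (λ t → bit (both χ t) + (bit (both χ t) + bit (one χ t)))
        ≡⟨ sumBits-+ n (bit ∘ both χ) _ ⟩
      cb + sumBits n (λ t → bit (both χ t) + bit (one χ t))
        ≡⟨ cong (cb +_) (sumBits-+ n (bit ∘ both χ) (bit ∘ one χ)) ⟩
      cb + (cb + co)
        ∎
      where
      open ≡-Reasoning
      bit-pair : ∀ a b → bit a + bit b ≡ bit (a ∧ b) + (bit (a ∧ b) + bit (a xor b))
      bit-pair true  true  = refl
      bit-pair true  false = refl
      bit-pair false true  = refl
      bit-pair false false = refl

    split = even-split co (cb + 2 ^ m) (2 ^ n)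
      (trans (solve 3 (λ b o p → o :+ con 2 :* (b :+ p) := b :+ (b :+ o) :+ con 2 :* p) refl cb co (2 ^ m))
             (trans (cong (_+ 2 * 2 ^ m) (sym pairs)) eq))
    K = proj₁ split
    co≡2K = proj₁ (proj₂ split)
    K+cb+2^m≡2^n = proj₂ (proj₂ split)

    chosen = choose (one χ) K (subst (K ≤_) (sym co≡2K) (m≤m+n K (K + 0)))
    σ = proj₁ chosen
    σ⊆one = proj₁ (proj₂ chosen)
    #σ≡K = proj₂ (proj₂ chosen)

    open FirstLayer χ σ

    count-toward : ∀ h → count (λ t → one χ t ∧ agree (σ t) h) ≡ K
    count-toward true  = trans (count-∧-⊆ σ⊆one) #σ≡K
    count-toward false = +-cancelʳ-≡ K _ K (begin
      count (λ t → one χ t ∧ not (σ t)) + K        ≡⟨ cong (count (λ t → one χ t ∧ not (σ t)) +_) (sym #σ≡K) ⟩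
      count (λ t → one χ t ∧ not (σ t)) + count σ  ≡⟨ count-∧-not-⊆ σ⊆one ⟩
      co                                           ≡⟨ co≡2K ⟩
      K + (K + 0)                                  ≡⟨ cong (K +_) (+-identityʳ K) ⟩
      K + K                                        ∎)
      where open ≡-Reasoning

    balanced : ∀ h → count (enters h) + 2 ^ m ≡ 2 ^ n
    balanced h = begin
      count (enters h) + 2 ^ m  ≡⟨ cong (_+ 2 ^ m) (trans (count-enters h) (cong (cb +_) (count-toward h))) ⟩
      cb + K + 2 ^ m            ≡⟨ solve 3 (λ b k p → b :+ k :+ p := k :+ (b :+ p)) refl cb K (2 ^ m) ⟩
      K + (cb + 2 ^ m)          ≡⟨ K+cb+2^m≡2^n ⟩
      2 ^ n                     ∎
      where open ≡-Reasoning

  point-routing : ∀ {n} (χ : Bits n → Bool) → count χ + 1 ≡ 2 ^ n → ∀ c → Routing χ (_≡ c)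
  point-routing {zero} χ eq [] = record
    { target   = id
    ; disjoint = λ _ {s} c _ _ → ⊥-elim (empty s c)
    ; avoids   = λ {s} c _ → empty s c
    ; onto     = λ {y} y≢[] → ⊥-elim (y≢[] (bits0 y))
    }
    where
    empty : ∀ s → χ s ≢ true
    empty [] c = contradiction (trans (cong (λ b → bit b + 1) (sym c)) eq) λ ()
    bits0 : ∀ (y : Bits 0) → y ≡ []
    bits0 [] = refl
  point-routing {suc n} χ eq (c₀ ∷ c) = extend R
    where
    open FirstLayer χ (λ _ → not c₀)
    halves = nearly-full χ eq
    R : ∀ h → Routing (enters h) ((_≡ c₀ ∷ c) ∘ (h ∷_))
    R h with h Bool.≟ c₀
    ... | yes refl = Routing-resp (cong (c₀ ∷_) , ∷-injectiveʳ) (point-routing (enters c₀) count-enters-c₀ c)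
      where
      count-enters-c₀ : count (enters c₀) + 1 ≡ 2 ^ n
      count-enters-c₀ = trans (cong (_+ 1) (sumBits-cong n λ t → cong bit (enters-away {c₀} {t} refl))) (proj₁ halves)
    ... | no h≢c₀  = Routing-resp ((λ ()) , λ e → h≢c₀ (∷-injectiveˡ e))
                       (identity-routing λ t → trans (enters-toward (sym (¬-not h≢c₀))) (proj₂ halves t))

  -- Pads with false when m > n; only used for m ≤ n.
  prefix : ∀ {n} m → Bits n → Bits m
  prefix zero    _       = []
  prefix (suc m) []      = false ∷ prefix m []
  prefix (suc m) (x ∷ v) = x ∷ prefix m v

  Transversal : ∀ {n} m → (Bits m → Bits n) → Set
  Transversal m ch = ∀ p → prefix m (ch p) ≡ p

  Image : ∀ {m n} → (Bits m → Bits n) → Bits n → Set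
  Image ch y = ∃[ p ] ch p ≡ y

  Image-point : ∀ {n} (ch : Bits 0 → Bits n) → (_≡ ch []) ≐ Image ch
  Image-point ch = (λ e → [] , sym e) , λ { ([] , e) → sym e }

  branch : ∀ {m n} → (Bits (suc m) → Bits (suc n)) → Bool → Bits m → Bits n
  branch ch h = tail ∘ ch ∘ (h ∷_)

  module _ {m n} {ch : Bits (suc m) → Bits (suc n)} (ch-transversal : Transversal (suc m) ch) where

    branch-∷ : ∀ h p → ch (h ∷ p) ≡ h ∷ branch ch h p × prefix m (branch ch h p) ≡ p
    branch-∷ h p = split (ch (h ∷ p)) (ch-transversal (h ∷ p))
      where
      split : ∀ v → prefix (suc m) v ≡ h ∷ p → v ≡ h ∷ tail v × prefix m (tail v) ≡ p
      split (x ∷ v) eq = cong (_∷ v) (∷-injectiveˡ eq) , ∷-injectiveʳ eq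

    Transversal-branch : ∀ h → Transversal m (branch ch h)
    Transversal-branch h = proj₂ ∘ branch-∷ h

    Image-branch : ∀ h → Image (branch ch h) ≐ (Image ch ∘ (h ∷_))
    Image-branch h = image-∷ , image-branch
      where
      image-∷ : ∀ {t} → Image (branch ch h) t → Image ch (h ∷ t)
      image-∷ (p , refl) = h ∷ p , proj₁ (branch-∷ h p)
      image-branch : ∀ {t} → Image ch (h ∷ t) → Image (branch ch h) t
      image-branch (h' ∷ p , e) with ∷-injectiveˡ (trans (sym (proj₁ (branch-∷ h' p))) e)
      ... | refl = p , cong tail e

  transversal-routing : ∀ {n m} → m ≤ n → (χ : Bits n → Bool) → count χ + 2 ^ m ≡ 2 ^ n →
                        (ch : Bits m → Bits n) → Transversal m ch → Routing χ (Image ch)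
  transversal-routing {m = zero} _ χ eq ch _ = Routing-resp (Image-point ch) (point-routing χ eq (ch []))
  transversal-routing {suc n} {suc m} (s≤s m≤n) χ eq ch ch-transversal = FirstLayer.extend χ side λ h →
    Routing-resp (Image-branch ch-transversal h)
      (transversal-routing m≤n (FirstLayer.enters χ side h) (balanced h) (branch ch h) (Transversal-branch ch-transversal h))
    where
    side = proj₁ (balanced-side {n} {m} χ eq)
    balanced = proj₂ (balanced-side {n} {m} χ eq)

  AgreeExcept : ∀ {n} → ℕ → Bits n → Bits n → Set
  AgreeExcept {n} k w w' = (i : Fin n) → toℕ i ≢ k → lookup w i ≡ lookup w' i

  splice-step : ∀ {n} i (t s : Bits n) → AgreeExcept i (splice i t s) (splice (suc i) t s)
  splice-step zero    (x ∷ t) (y ∷ s) fzero    0≢0 = contradiction refl 0≢0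
  splice-step zero    (x ∷ t) (y ∷ s) (fsuc k) _   = refl
  splice-step (suc i) (x ∷ t) (y ∷ s) fzero    _   = refl
  splice-step (suc i) (x ∷ t) (y ∷ s) (fsuc k) k≢i = splice-step i t s k (k≢i ∘ cong suc)

  rev : ∀ {n} → Bits n → Bits n
  rev v = tabulate (lookup v ∘ opposite)

  lookup-rev : ∀ {n} (v : Bits n) i → lookup (rev v) i ≡ lookup v (opposite i)
  lookup-rev v = lookup∘tabulate (lookup v ∘ opposite)

  rev-involutive : ∀ {n} (v : Bits n) → rev (rev v) ≡ v
  rev-involutive v = trans (tabulate-cong λ i → trans (lookup-rev v (opposite i)) (cong (lookup v) (opposite-involutive i)))
                           (tabulate∘lookup v)

  rev-injective : ∀ {n} {u v : Bits n} → rev u ≡ rev v → u ≡ v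
  rev-injective {u = u} {v} eq = trans (sym (rev-involutive u)) (trans (cong rev eq) (rev-involutive v))

  -- Read backwards in reversed coordinates, a butterfly path is again a butterfly path.
  rev-splice-step : ∀ {n} j (t s : Bits n) → j < n →
                    AgreeExcept j (rev (splice (n ∸ j) t s)) (rev (splice (n ∸ suc j) t s))
  rev-splice-step {n} j t s j<n i i≢j = begin
    lookup (rev (splice (n ∸ j) t s)) i              ≡⟨ lookup-rev (splice (n ∸ j) t s) i ⟩
    lookup (splice (n ∸ j) t s) (opposite i)         ≡⟨ cong (λ k → lookup (splice k t s) (opposite i)) n∸j≡1+n∸[1+j] ⟩
    lookup (splice (suc (n ∸ suc j)) t s) (opposite i) ≡⟨ sym (splice-step (n ∸ suc j) t s (opposite i) opposite-i≢) ⟩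
    lookup (splice (n ∸ suc j) t s) (opposite i)     ≡⟨ sym (lookup-rev (splice (n ∸ suc j) t s) i) ⟩
    lookup (rev (splice (n ∸ suc j) t s)) i          ∎
    where
    open ≡-Reasoning
    n∸j≡1+n∸[1+j] : n ∸ j ≡ suc (n ∸ suc j)
    n∸j≡1+n∸[1+j] = +-∸-assoc 1 j<n
    opposite-i≢ : toℕ (opposite i) ≢ n ∸ suc j
    opposite-i≢ eq = i≢j (suc-injective (∸-cancelˡ-≡ (toℕ<n i) j<n (trans (sym (opposite-prop i)) eq)))

module TwoColouring where

  open import Data.Nat using (suc; _≤_; s≤s; s≤s⁻¹)
  open import Data.Nat.Properties using (≤-trans)
  open import Data.Bool using (Bool; true; not)
  open import Data.Bool.Properties using (not-¬)
  open import Data.List using (List; []; _∷_; length; filter)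
  open import Data.List.Properties using (filter-notAll)
  open import Data.List.Membership.Propositional using (_∈_; lose)
  open import Data.List.Membership.Propositional.Properties using (∈-filter⁺; ∈-filter⁻)
  open import Data.List.Relation.Unary.Any using (here)
  open import Data.Product using (∃-syntax; _×_; _,_; proj₁; proj₂)
  open import Relation.Nullary using (Dec; yes; no; ¬?; contradiction)
  open import Relation.Nullary.Decidable using (_×-dec_)
  open import Relation.Binary.Definitions using (DecidableEquality)
  open import Relation.Binary.PropositionalEquality
  open import Function using (_∘_)

  module _ {X : Set} (_≟_ : DecidableEquality X) where

    record IsPerfectMatching (E : List X) (a : X → X) : Set where
      field
        closed     : ∀ {z} → z ∈ E → a z ∈ E
        involutive : ∀ {z} → z ∈ E → a (a z) ≡ z
        no-fixed   : ∀ {z} → z ∈ E → a z ≢ z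

      injective : ∀ {z w} → z ∈ E → w ∈ E → a z ≡ a w → z ≡ w
      injective z∈ w∈ eq = trans (sym (involutive z∈)) (trans (cong a eq) (involutive w∈))

    ProperAt : (X → X) → (X → X) → (X → Bool) → X → Set
    ProperAt a b c z = c (a z) ≢ c z × c (b z) ≢ c z

    ProperColouring : (X → X) → (X → X) → List X → (X → Bool) → Set
    ProperColouring a b E c = ∀ {z} → z ∈ E → ProperAt a b c z

    -- Remove e and a e and rejoin their b-partners x = b e and y = b (a e) to each other; a proper
    -- colouring of the smaller instance extends by colouring e unlike x and a e like x.
    module Contraction (e : X) (E : List X) (e∈E : e ∈ E) (a b : X → X)
                       (A : IsPerfectMatching E a) (B : IsPerfectMatching E b) where

      private
        module A = IsPerfectMatching A
        module B = IsPerfectMatching B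

      Away : X → Set
      Away z = z ≢ e × z ≢ a e

      away? : ∀ z → Dec (Away z)
      away? z = ¬? (z ≟ e) ×-dec ¬? (z ≟ a e)

      E' : List X
      E' = filter away? E

      E'-shorter : suc (length E') ≤ length E
      E'-shorter = filter-notAll away? E (lose e∈E λ away → proj₁ away refl)

      ∈E' : ∀ {z} → z ∈ E → Away z → z ∈ E'
      ∈E' = ∈-filter⁺ away?

      E'⊆E : ∀ {z} → z ∈ E' → z ∈ E
      E'⊆E = proj₁ ∘ ∈-filter⁻ away? {xs = E}

      away : ∀ {z} → z ∈ E' → Away z
      away = proj₂ ∘ ∈-filter⁻ away? {xs = E}

      ae∈E : a e ∈ E
      ae∈E = A.closed e∈E

      x y : X
      x = b e
      y = b (a e)

      x≢y : x ≢ y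
      x≢y eq = A.no-fixed e∈E (sym (B.injective e∈E ae∈E eq))

      y≢e⇒x∈E' : y ≢ e → x ∈ E'
      y≢e⇒x∈E' y≢e =
        ∈E' (B.closed e∈E) (B.no-fixed e∈E , λ x≡ae → y≢e (trans (cong b (sym x≡ae)) (B.involutive e∈E)))

      x∈E'⇒y≢e : x ∈ E' → y ≢ e
      x∈E'⇒y≢e x∈ y≡e = proj₂ (away x∈) (sym (trans (sym (B.involutive ae∈E)) (cong b y≡e)))

      b' : X → X
      b' z with z ≟ x | z ≟ y
      ... | yes _ | _     = y
      ... | no _  | yes _ = x
      ... | no _  | no _  = b z

      b'-x : b' x ≡ y
      b'-x with x ≟ x
      ... | yes _  = refl
      ... | no x≢x = contradiction refl x≢x

      b'-y : b' y ≡ x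
      b'-y with y ≟ x | y ≟ y
      ... | yes y≡x | _     = contradiction (sym y≡x) x≢y
      ... | no _    | yes _ = refl
      ... | no _    | no y≢y = contradiction refl y≢y

      b'-other : ∀ {z} → z ≢ x → z ≢ y → b' z ≡ b z
      b'-other {z} z≢x z≢y with z ≟ x | z ≟ y
      ... | yes z≡x | _       = contradiction z≡x z≢x
      ... | no _    | yes z≡y = contradiction z≡y z≢y
      ... | no _    | no _    = refl

      b-away : ∀ {z} → z ∈ E' → z ≢ x → z ≢ y → Away (b z)
      b-away z∈ z≢x z≢y =
          (λ bz≡e → z≢x (B.injective (E'⊆E z∈) (B.closed e∈E) (trans bz≡e (sym (B.involutive e∈E)))))
        , (λ bz≡ae → z≢y (B.injective (E'⊆E z∈) (B.closed ae∈E) (trans bz≡ae (sym (B.involutive ae∈E)))))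

      bz≢x : ∀ {z} → z ∈ E' → b z ≢ x
      bz≢x z∈ bz≡x = proj₁ (away z∈) (B.injective (E'⊆E z∈) e∈E bz≡x)

      bz≢y : ∀ {z} → z ∈ E' → b z ≢ y
      bz≢y z∈ bz≡y = proj₂ (away z∈) (B.injective (E'⊆E z∈) ae∈E bz≡y)

      A' : IsPerfectMatching E' a
      A' = record
        { closed     = λ z∈ → ∈E' (A.closed (E'⊆E z∈))
                         ( (λ az≡e → proj₂ (away z∈) (trans (sym (A.involutive (E'⊆E z∈))) (cong a az≡e)))
                         , (λ az≡ae → proj₁ (away z∈) (A.injective (E'⊆E z∈) e∈E az≡ae)) )
        ; involutive = A.involutive ∘ E'⊆E
        ; no-fixed   = A.no-fixed ∘ E'⊆E
        }

      B' : IsPerfectMatching E' b'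
      B' = record { closed = closed ; involutive = involutive ; no-fixed = no-fixed }
        where
        closed : ∀ {z} → z ∈ E' → b' z ∈ E'
        closed {z} z∈ with z ≟ x | z ≟ y
        ... | yes refl | _        = ∈E' (B.closed ae∈E) (x∈E'⇒y≢e z∈ , B.no-fixed ae∈E)
        ... | no _     | yes refl = y≢e⇒x∈E' (proj₁ (away z∈))
        ... | no z≢x   | no z≢y   = ∈E' (B.closed (E'⊆E z∈)) (b-away z∈ z≢x z≢y)
        involutive : ∀ {z} → z ∈ E' → b' (b' z) ≡ z
        involutive {z} z∈ with z ≟ x | z ≟ y
        ... | yes refl | _        = b'-y
        ... | no _     | yes refl = b'-x
        ... | no _     | no _     = trans (b'-other (bz≢x z∈) (bz≢y z∈)) (B.involutive (E'⊆E z∈))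
        no-fixed : ∀ {z} → z ∈ E' → b' z ≢ z
        no-fixed {z} z∈ with z ≟ x | z ≟ y
        ... | yes refl | _        = x≢y ∘ sym
        ... | no _     | yes refl = x≢y
        ... | no _     | no _     = B.no-fixed (E'⊆E z∈)

      recolour : (X → Bool) → X → Bool
      recolour c z with z ≟ e | z ≟ a e
      ... | yes _ | _     = not (c x)
      ... | no _  | yes _ = c x
      ... | no _  | no _  = c z

      recolour-e : ∀ c → recolour c e ≡ not (c x)
      recolour-e c with e ≟ e
      ... | yes _  = refl
      ... | no e≢e = contradiction refl e≢e

      recolour-ae : ∀ c → recolour c (a e) ≡ c x
      recolour-ae c with a e ≟ e | a e ≟ a e
      ... | yes ae≡e | _ = contradiction ae≡e (A.no-fixed e∈E)
      ... | no _ | yes _ = refl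
      ... | no _ | no ae≢ae = contradiction refl ae≢ae

      recolour-away : ∀ c {z} → Away z → recolour c z ≡ c z
      recolour-away c {z} (z≢e , z≢ae) with z ≟ e | z ≟ a e
      ... | yes z≡e | _        = contradiction z≡e z≢e
      ... | no _    | yes z≡ae = contradiction z≡ae z≢ae
      ... | no _    | no _     = refl

      recolour-x : ∀ c → recolour c x ≡ c x
      recolour-x c = by-cases (x ≟ a e)
        where
        by-cases : Dec (x ≡ a e) → recolour c x ≡ c x
        by-cases (yes x≡ae) = trans (cong (recolour c) x≡ae) (recolour-ae c)
        by-cases (no x≢ae)  = recolour-away c (B.no-fixed e∈E , x≢ae)

      module Extension {c : X → Bool} (proper : ProperColouring a b' E' c) where

        private
          c' = recolour c

          opposite : c x ≢ not (c x)
          opposite = not-¬ refl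

        proper-at-e : ProperAt a b c' e
        proper-at-e = differ (recolour-ae c) , differ (recolour-x c)
          where
          differ : ∀ {w} → c' w ≡ c x → c' w ≢ c' e
          differ eq eq' = opposite (trans (sym eq) (trans eq' (recolour-e c)))

        proper-at-ae : ProperAt a b c' (a e)
        proper-at-ae = (λ eq → opposite (sym (begin
                         not (c x)      ≡⟨ sym (recolour-e c) ⟩
                         c' e           ≡⟨ cong c' (sym (A.involutive e∈E)) ⟩
                         c' (a (a e))   ≡⟨ eq ⟩
                         c' (a e)       ≡⟨ recolour-ae c ⟩
                         c x            ∎)))
                     , λ eq → y-side (y ≟ e) (trans eq (recolour-ae c))
          where
          open ≡-Reasoning
          y-side : Dec (y ≡ e) → c' y ≢ c x
          y-side (yes y≡e) eq = opposite (sym (trans (sym (recolour-e c)) (trans (cong c' (sym y≡e)) eq)))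
          y-side (no y≢e)  eq = proj₂ (proper (y≢e⇒x∈E' y≢e))
            (trans (cong c b'-x) (trans (sym (recolour-away c (y≢e , B.no-fixed ae∈E))) eq))

        proper-away : ∀ {z} → z ∈ E' → ProperAt a b c' z
        proper-away {z} z∈ = (λ eq → proj₁ (proper z∈) (begin
                               c (a z)   ≡⟨ sym (recolour-away c (away (IsPerfectMatching.closed A' z∈))) ⟩
                               c' (a z)  ≡⟨ eq ⟩
                               c' z      ≡⟨ recolour-away c (away z∈) ⟩
                               c z       ∎))
                           , b-side (z ≟ x) (z ≟ y)
          where
          open ≡-Reasoning
          b-side : Dec (z ≡ x) → Dec (z ≡ y) → c' (b z) ≢ c' z
          b-side (yes refl) _ eq = opposite (begin
            c x          ≡⟨ sym (recolour-x c) ⟩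
            c' x         ≡⟨ sym eq ⟩
            c' (b (b e)) ≡⟨ cong c' (B.involutive e∈E) ⟩
            c' e         ≡⟨ recolour-e c ⟩
            not (c x)    ∎)
          b-side (no _) (yes refl) eq = proj₂ (proper z∈) (begin
            c (b' y)     ≡⟨ cong c b'-y ⟩
            c x          ≡⟨ sym (recolour-ae c) ⟩
            c' (a e)     ≡⟨ cong c' (sym (B.involutive ae∈E)) ⟩
            c' (b y)     ≡⟨ eq ⟩
            c' y         ≡⟨ recolour-away c (away z∈) ⟩
            c y          ∎)
          b-side (no z≢x) (no z≢y) eq = proj₂ (proper z∈) (begin
            c (b' z)     ≡⟨ cong c (b'-other z≢x z≢y) ⟩
            c (b z)      ≡⟨ sym (recolour-away c (b-away z∈ z≢x z≢y)) ⟩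
            c' (b z)     ≡⟨ eq ⟩
            c' z         ≡⟨ recolour-away c (away z∈) ⟩
            c z          ∎)

        recolour-proper : ProperColouring a b E c'
        recolour-proper {z} z∈ = by-cases (z ≟ e) (z ≟ a e)
          where
          by-cases : Dec (z ≡ e) → Dec (z ≡ a e) → ProperAt a b c' z
          by-cases (yes z≡e) _          = subst (ProperAt a b c') (sym z≡e) proper-at-e
          by-cases (no _)    (yes z≡ae) = subst (ProperAt a b c') (sym z≡ae) proper-at-ae
          by-cases (no z≢e)  (no z≢ae)  = proper-away (∈E' z∈ (z≢e , z≢ae))

    two-colouring : ∀ n (E : List X) → length E ≤ n → ∀ {a b} →
                    IsPerfectMatching E a → IsPerfectMatching E b → ∃[ c ] ProperColouring a b E c
    two-colouring n       []      _         _ _ = (λ _ → true) , λ ()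
    two-colouring (suc n) (e ∷ E) (s≤s len) {a} {b} A B with
      two-colouring n E' (s≤s⁻¹ (≤-trans E'-shorter (s≤s len))) A' B'
      where open Contraction e (e ∷ E) (here refl) a b A B
    ... | c , proper = recolour c , Extension.recolour-proper proper
      where open Contraction e (e ∷ E) (here refl) a b A B

module Transversals where

  open import Data.Nat using (ℕ; zero; suc; _+_)
  open import Data.Nat.Properties using (+-suc; +-identityʳ; ≤-refl)
  open import Data.Bool using (Bool; true; false; not; if_then_else_)
  open import Data.Bool.Properties using (not-involutive; not-¬)
  open import Data.Vec using ([]; _∷_; _∷ʳ_; init; last; initLast)
  open import Data.Vec.Properties using (init-∷ʳ; last-∷ʳ)
  open import Data.List using (List; []; _∷_; _++_; map; length)
  open import Data.List.Membership.Propositional using (_∈_)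
  open import Data.List.Membership.Propositional.Properties using (∈-map⁺; ∈-++⁺ˡ; ∈-++⁺ʳ)
  open import Data.List.Relation.Unary.Any using (here)
  open import Data.Product using (proj₁; proj₂)
  open import Data.Sum using (_⊎_; inj₁; inj₂)
  open import Function using (_∘_)
  open import Relation.Binary.PropositionalEquality
  open import Relation.Nullary using (contradiction)
  open Cube
  open SingleButterfly using (prefix; Transversal)
  open TwoColouring

  allBits : ∀ n → List (Bits n)
  allBits zero    = [] ∷ []
  allBits (suc n) = map (false ∷_) (allBits n) ++ map (true ∷_) (allBits n)

  ∈-allBits : ∀ {n} (v : Bits n) → v ∈ allBits n
  ∈-allBits []          = here refl
  ∈-allBits (false ∷ v) = ∈-++⁺ˡ (∈-map⁺ (false ∷_) (∈-allBits v))
  ∈-allBits {suc n} (true ∷ v) = ∈-++⁺ʳ (map (false ∷_) (allBits n)) (∈-map⁺ (true ∷_) (∈-allBits v))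

  init-∷ʳ-last : ∀ {n} (v : Bits (suc n)) → init v ∷ʳ last v ≡ v
  init-∷ʳ-last v = sym (proj₂ (proj₂ (initLast v)))

  last-cases : ∀ {n} (v : Bits (suc n)) → v ≡ init v ∷ʳ false ⊎ v ≡ init v ∷ʳ true
  last-cases v with last v in lv
  ... | false = inj₁ (trans (sym (init-∷ʳ-last v)) (cong (init v ∷ʳ_) lv))
  ... | true  = inj₂ (trans (sym (init-∷ʳ-last v)) (cong (init v ∷ʳ_) lv))

  flip-last : ∀ {n} → Bits (suc n) → Bits (suc n)
  flip-last v = init v ∷ʳ not (last v)

  flip-last-∷ʳ : ∀ {n} (p : Bits n) x → flip-last (p ∷ʳ x) ≡ p ∷ʳ not x
  flip-last-∷ʳ p x = cong₂ _∷ʳ_ (init-∷ʳ x p) (cong not (last-∷ʳ x p))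

  flip-last-involutive : ∀ {n} (v : Bits (suc n)) → flip-last (flip-last v) ≡ v
  flip-last-involutive v = begin
    flip-last (init v ∷ʳ not (last v)) ≡⟨ flip-last-∷ʳ (init v) (not (last v)) ⟩
    init v ∷ʳ not (not (last v))       ≡⟨ cong (init v ∷ʳ_) (not-involutive (last v)) ⟩
    init v ∷ʳ last v                   ≡⟨ init-∷ʳ-last v ⟩
    v                                  ∎
    where open ≡-Reasoning

  flip-last-no-fixed : ∀ {n} (v : Bits (suc n)) → flip-last v ≢ v
  flip-last-no-fixed v eq = not-¬ refl (sym (trans (sym (last-∷ʳ (not (last v)) (init v))) (cong last eq)))

  prefix-init : ∀ {n} j (v : Bits n) → prefix j v ≡ init (prefix (suc j) v)
  prefix-init zero    []      = refl
  prefix-init zero    (x ∷ v) = refl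
  prefix-init (suc j) []      = cong (false ∷_) (prefix-init j [])
  prefix-init (suc j) (x ∷ v) = cong (x ∷_) (prefix-init j v)

  prefix-all : ∀ {n} (v : Bits n) → prefix n v ≡ v
  prefix-all []      = refl
  prefix-all (x ∷ v) = cong (x ∷_) (prefix-all v)

  module _ {X : Set} (c : X → Bool) where

    trueOf : X → X → X
    trueOf u v = if c u then u else v

    trueOf-cases : ∀ u v → trueOf u v ≡ u ⊎ trueOf u v ≡ v
    trueOf-cases u v with c u
    ... | true  = inj₁ refl
    ... | false = inj₂ refl

    trueOf-true : ∀ {u v} → c u ≢ c v → c (trueOf u v) ≡ true
    trueOf-true {u} {v} ne with c u in cu | c v in cv
    ... | true  | _     = cu
    ... | false | true  = cv
    ... | false | false = contradiction refl ne

    trueOf-unique : ∀ {u v w} → c u ≢ c v → c w ≡ true → w ≡ u ⊎ w ≡ v → trueOf u v ≡ w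
    trueOf-unique ne cw (inj₁ refl) rewrite cw = refl
    trueOf-unique {u} ne cw (inj₂ refl) with c u in cu
    ... | true  = contradiction (sym cw) ne
    ... | false = refl

  module _ {d} (τ τ⁻¹ : Bits d → Bits d)
           (τ∘τ⁻¹ : ∀ v → τ (τ⁻¹ v) ≡ v) (τ⁻¹∘τ : ∀ v → τ⁻¹ (τ v) ≡ v) where

    record CommonTransversal (j : ℕ) : Set where
      field
        pick             : Bits j → Bits d
        back             : Bits j → Bits j
        pick-transversal : Transversal j pick
        back-transversal : Transversal j (τ ∘ pick ∘ back)
        back-inverse     : ∀ p → back (prefix j (τ (pick p))) ≡ p

    full-transversal : CommonTransversal d
    full-transversal = record
      { pick             = λ p → p
      ; back             = τ⁻¹
      ; pick-transversal = prefix-all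
      ; back-transversal = λ q → trans (prefix-all _) (τ∘τ⁻¹ q)
      ; back-inverse     = λ p → trans (cong τ⁻¹ (prefix-all (τ p))) (τ⁻¹∘τ p)
      }

    -- The two elements of a j-prefix class are e and flip-last e on the pick side, e and partner e on
    -- the τ side. Keeping the elements coloured true halves both transversals at once.
    module Halving {j} (T : CommonTransversal (suc j)) where

      open CommonTransversal T
      open ≡-Reasoning

      σ : Bits (suc j) → Bits (suc j)
      σ e = prefix (suc j) (τ (pick e))

      partner : Bits (suc j) → Bits (suc j)
      partner e = back (flip-last (σ e))

      A : IsPerfectMatching _≟ᴮ_ (allBits (suc j)) flip-last
      A = record
        { closed     = λ {z} _ → ∈-allBits (flip-last z)
        ; involutive = λ {z} _ → flip-last-involutive z
        ; no-fixed   = λ {z} _ → flip-last-no-fixed z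
        }

      B : IsPerfectMatching _≟ᴮ_ (allBits (suc j)) partner
      B = record
        { closed     = λ {z} _ → ∈-allBits (partner z)
        ; involutive = λ {z} _ → begin
            back (flip-last (σ (back (flip-last (σ z))))) ≡⟨ cong (back ∘ flip-last) (back-transversal _) ⟩
            back (flip-last (flip-last (σ z)))            ≡⟨ cong back (flip-last-involutive (σ z)) ⟩
            back (σ z)                                    ≡⟨ back-inverse z ⟩
            z                                             ∎
        ; no-fixed   = λ {z} _ eq → flip-last-no-fixed (σ z) (trans (sym (back-transversal _)) (cong σ eq))
        }

      colouring = two-colouring _≟ᴮ_ (length (allBits (suc j))) (allBits (suc j)) ≤-refl A B
      c = proj₁ colouring
      proper = proj₂ colouring

      chosen : Bits j → Bits (suc j)
      chosen p = trueOf c (p ∷ʳ false) (p ∷ʳ true)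

      chosenBack : Bits j → Bits (suc j)
      chosenBack q = trueOf c (back (q ∷ʳ false)) (back (q ∷ʳ true))

      pair-differs : ∀ p → c (p ∷ʳ false) ≢ c (p ∷ʳ true)
      pair-differs p eq = proj₁ (proper (∈-allBits (p ∷ʳ false)))
        (trans (cong c (flip-last-∷ʳ p false)) (sym eq))

      back-pair-differs : ∀ q → c (back (q ∷ʳ false)) ≢ c (back (q ∷ʳ true))
      back-pair-differs q eq = proj₂ (proper (∈-allBits (back (q ∷ʳ false))))
        (trans (cong (c ∘ back) (trans (cong flip-last (back-transversal _)) (flip-last-∷ʳ q false))) (sym eq))

      init-chosen : ∀ p → init (chosen p) ≡ p
      init-chosen p with trueOf-cases c (p ∷ʳ false) (p ∷ʳ true)
      ... | inj₁ eq = trans (cong init eq) (init-∷ʳ false p)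
      ... | inj₂ eq = trans (cong init eq) (init-∷ʳ true p)

      init-σ-chosenBack : ∀ q → init (σ (chosenBack q)) ≡ q
      init-σ-chosenBack q with trueOf-cases c (back (q ∷ʳ false)) (back (q ∷ʳ true))
      ... | inj₁ eq = trans (cong (init ∘ σ) eq) (trans (cong init (back-transversal _)) (init-∷ʳ false q))
      ... | inj₂ eq = trans (cong (init ∘ σ) eq) (trans (cong init (back-transversal _)) (init-∷ʳ true q))

      chosen-init : ∀ {w} → c w ≡ true → chosen (init w) ≡ w
      chosen-init {w} cw = trueOf-unique c (pair-differs (init w)) cw (last-cases w)

      chosenBack-init : ∀ {w} → c w ≡ true → chosenBack (init (σ w)) ≡ w
      chosenBack-init {w} cw = trueOf-unique c (back-pair-differs (init (σ w))) cw w-cases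
        where
        w-cases : w ≡ back (init (σ w) ∷ʳ false) ⊎ w ≡ back (init (σ w) ∷ʳ true)
        w-cases with last-cases (σ w)
        ... | inj₁ eq = inj₁ (trans (sym (back-inverse w)) (cong back eq))
        ... | inj₂ eq = inj₂ (trans (sym (back-inverse w)) (cong back eq))

      halved : CommonTransversal j
      halved = record
        { pick             = pick ∘ chosen
        ; back             = init ∘ chosenBack
        ; pick-transversal = λ p → trans (prefix-init j _) (trans (cong init (pick-transversal (chosen p))) (init-chosen p))
        ; back-transversal = λ q → trans (prefix-init j _) (begin
            init (σ (chosen (init (chosenBack q))))  ≡⟨ cong (init ∘ σ) (chosen-init (trueOf-true c (back-pair-differs q))) ⟩
            init (σ (chosenBack q))                  ≡⟨ init-σ-chosenBack q ⟩
            q                                        ∎)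
        ; back-inverse     = λ p → begin
            init (chosenBack (prefix j (τ (pick (chosen p)))))  ≡⟨ cong (init ∘ chosenBack) (prefix-init j _) ⟩
            init (chosenBack (init (σ (chosen p))))             ≡⟨ cong init (chosenBack-init (trueOf-true c (pair-differs p))) ⟩
            init (chosen p)                                     ≡⟨ init-chosen p ⟩
            p                                                   ∎
        }

    descend : ∀ k {j} → j + k ≡ d → CommonTransversal j
    descend zero    {j} eq = subst CommonTransversal (sym (trans (sym (+-identityʳ j)) eq)) full-transversal
    descend (suc k) {j} eq = Halving.halved (descend k (trans (sym (+-suc j k)) eq))

module Lists where

  open import Data.Nat using (ℕ; zero; suc; _<_; z≤n; s≤s)
  open import Data.List using (List; []; _∷_; concat; applyUpTo)
  open import Data.List.Membership.Propositional using (_∈_; mapWith∈)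
  open import Data.List.Membership.Propositional.Properties using (∈-concat⁻′)
  open import Data.List.Relation.Unary.All as All using (All; []; _∷_)
  open import Data.List.Relation.Unary.AllPairs using ([]; _∷_)
  open import Data.List.Relation.Unary.Any using (here; there)
  open import Data.List.Relation.Unary.Any.Properties using (mapWith∈⁻)
  open import Data.List.Relation.Unary.Unique.Propositional using (Unique)
  open import Data.List.Relation.Unary.Unique.Propositional.Properties using (++⁺)
  open import Data.Product using (_×_; _,_)
  open import Function using (_∘_)
  open import Relation.Binary.PropositionalEquality

  module _ {A B : Set} where

    all-mapWith∈ : ∀ {P : B → Set} (xs : List A) (f : ∀ {x} → x ∈ xs → B) →
                   (∀ {x} (p : x ∈ xs) → P (f p)) → All P (mapWith∈ xs f)
    all-mapWith∈ []       f Pf = []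
    all-mapWith∈ (x ∷ xs) f Pf = Pf (here refl) ∷ all-mapWith∈ xs (f ∘ there) (Pf ∘ there)

    unique-mapWith∈ : ∀ (xs : List A) (f : ∀ {x} → x ∈ xs → B) → Unique xs →
                      (∀ {x y} (p : x ∈ xs) (q : y ∈ xs) → f p ≡ f q → x ≡ y) → Unique (mapWith∈ xs f)
    unique-mapWith∈ []       f _          _   = []
    unique-mapWith∈ (x ∷ xs) f (x∉ ∷ uxs) inj =
      All.tabulate fresh ∷ unique-mapWith∈ xs (f ∘ there) uxs (λ p q → inj (there p) (there q))
      where
      fresh : ∀ {z} → z ∈ mapWith∈ xs (f ∘ there) → f (here refl) ≢ z
      fresh z∈ eq with mapWith∈⁻ xs (f ∘ there) z∈
      ... | y , y∈ , refl = All.lookup x∉ y∈ (inj (here refl) (there y∈) eq)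

    unique-concat-mapWith∈ : ∀ (xs : List A) (f : ∀ {x} → x ∈ xs → List B) → Unique xs →
                             (∀ {x} (p : x ∈ xs) → Unique (f p)) →
                             (∀ {x y z} (p : x ∈ xs) (q : y ∈ xs) → z ∈ f p → z ∈ f q → x ≡ y) →
                             Unique (concat (mapWith∈ xs f))
    unique-concat-mapWith∈ []       f _          _  _    = []
    unique-concat-mapWith∈ (x ∷ xs) f (x∉ ∷ uxs) uf meet =
      ++⁺ (uf (here refl)) (unique-concat-mapWith∈ xs (f ∘ there) uxs (uf ∘ there) (λ p q → meet (there p) (there q))) disjoint
      where
      disjoint : ∀ {z} → z ∈ f (here refl) × z ∈ concat (mapWith∈ xs (f ∘ there)) → _
      disjoint (z∈ , z∈rest) with ∈-concat⁻′ (mapWith∈ xs (f ∘ there)) z∈rest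
      ... | ys , z∈ys , ys∈ with mapWith∈⁻ xs (f ∘ there) ys∈
      ...   | y , y∈ , refl = All.lookup x∉ y∈ (meet (here refl) (there y∈) z∈ z∈ys)

  chain : ∀ {G : Digraph} (ψ : ℕ → Node G) n → (∀ k → k < n → Edge G (ψ k) (ψ (suc k))) → Walk G (ψ 0) (ψ n)
  chain ψ zero    edge = here (ψ 0)
  chain ψ (suc n) edge = step (edge 0 (s≤s z≤n)) (chain (ψ ∘ suc) n (λ k k<n → edge (suc k) (s≤s k<n)))

  walkNodes-chain : ∀ {G : Digraph} (ψ : ℕ → Node G) n (edge : ∀ k → k < n → Edge G (ψ k) (ψ (suc k))) →
                    walkNodes {G} (chain {G} ψ n edge) ≡ applyUpTo ψ (suc n)
  walkNodes-chain ψ zero    edge = refl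
  walkNodes-chain {G} ψ (suc n) edge = cong (ψ 0 ∷_) (walkNodes-chain {G} (ψ ∘ suc) n (λ k k<n → edge (suc k) (s≤s k<n)))

module Glued where

  open import Data.Nat using (ℕ; zero; suc; _+_; _∸_; _≤_; _<_; z≤n; s≤s; _≤?_)
  open import Data.Nat.Properties
  open import Data.Fin using (Fin; toℕ; fromℕ) renaming (zero to fzero; suc to fsuc)
  import Data.Fin.Properties as Fin
  open import Data.Product using (Σ; _×_; _,_; proj₁; proj₂)
  open import Data.Sum using (inj₁; inj₂)
  open import Function using (_∘_)
  open import Function.Bundles using (Inverse; Equivalence)
  open import Axiom.UniquenessOfIdentityProofs using (module Decidable⇒UIP)
  open import Relation.Nullary using (yes; no; contradiction)
  open import Relation.Binary.PropositionalEquality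
  open Cube using (Bits)
  open SingleButterfly using (AgreeExcept)

  clamp : ∀ n → ℕ → Fin (suc n)
  clamp n       zero    = fzero
  clamp zero    (suc i) = fzero
  clamp (suc n) (suc i) = fsuc (clamp n i)

  toℕ-clamp : ∀ n {i} → i ≤ n → toℕ (clamp n i) ≡ i
  toℕ-clamp n       z≤n       = refl
  toℕ-clamp (suc n) (s≤s i≤n) = cong suc (toℕ-clamp n i≤n)

  clamp-fromℕ : ∀ n → clamp n n ≡ fromℕ n
  clamp-fromℕ zero    = refl
  clamp-fromℕ (suc n) = cong fsuc (clamp-fromℕ n)

  module IsoToButterflyProperties {d G} (φ : IsoToButterfly d G) where
    open IsoToButterfly φ
    open Inverse iso public using (from)
    open Inverse iso using (to; strictlyInverseˡ; strictlyInverseʳ)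

    label : Node G → Bits d
    label = proj₂ ∘ to

    layer-from : ∀ i w → layer (from (i , w)) ≡ i
    layer-from i w = cong proj₁ (strictlyInverseˡ (i , w))

    label-from : ∀ i w → label (from (i , w)) ≡ w
    label-from i w = cong proj₂ (strictlyInverseˡ (i , w))

    from-layer-label : ∀ {u i} → layer u ≡ i → from (i , label u) ≡ u
    from-layer-label {u} refl = strictlyInverseʳ u

    edge : ∀ {i j w w'} → toℕ j ≡ suc (toℕ i) → AgreeExcept (toℕ i) w w' → Edge G (from (i , w)) (from (j , w'))
    edge {i} {j} {w} {w'} j≡1+i agree = Equivalence.from (preserve _ _)
      (subst₂ (SBEdge d) (sym (strictlyInverseˡ (i , w))) (sym (strictlyInverseˡ (j , w'))) (j≡1+i , agree))

  module Layout {d'} (P : PairOfButterflies (suc d')) where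
    open PairOfButterflies P

    D : ℕ
    D = suc d'

    module B₁ = IsoToButterflyProperties φ₁
    module B₂ = IsoToButterflyProperties φ₂

    out₁ : ∀ w → Φ₁.IsOut (B₁.from (clamp D D , w))
    out₁ w = trans (B₁.layer-from _ w) (clamp-fromℕ D)

    in₂ : ∀ v → Φ₂.IsIn (B₂.from (fzero , v))
    in₂ v = B₂.layer-from fzero v

    π : Bits D → Bits D
    π w = B₂.label (glueTo (B₁.from (clamp D D , w)) (out₁ w))

    π⁻¹ : Bits D → Bits D
    π⁻¹ v = B₁.label (proj₁ (Inverse.from glue (B₂.from (fzero , v) , in₂ v)))

    private
      out-≡ : ∀ {u u'} → u ≡ u' → (o : Φ₁.IsOut u) (o' : Φ₁.IsOut u') → _≡_ {A = Σ _ Φ₁.IsOut} (u , o) (u' , o')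
      out-≡ refl o o' = cong (_ ,_) (Decidable⇒UIP.≡-irrelevant Fin._≟_ o o')

      in-≡ : ∀ {v v'} → v ≡ v' → (i : Φ₂.IsIn v) (i' : Φ₂.IsIn v') → _≡_ {A = Σ _ Φ₂.IsIn} (v , i) (v' , i')
      in-≡ refl i i' = cong (_ ,_) (Decidable⇒UIP.≡-irrelevant Fin._≟_ i i')

    π∘π⁻¹ : ∀ v → π (π⁻¹ v) ≡ v
    π∘π⁻¹ v = begin
      B₂.label (proj₁ (Inverse.to glue (B₁.from (clamp D D , π⁻¹ v) , out₁ (π⁻¹ v))))
        ≡⟨ cong (B₂.label ∘ proj₁ ∘ Inverse.to glue)
                (out-≡ (B₁.from-layer-label (trans (proj₂ u) (sym (clamp-fromℕ D)))) _ (proj₂ u)) ⟩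
      B₂.label (proj₁ (Inverse.to glue u))  ≡⟨ cong (B₂.label ∘ proj₁) (Inverse.strictlyInverseˡ glue _) ⟩
      B₂.label (B₂.from (fzero , v))        ≡⟨ B₂.label-from fzero v ⟩
      v                                     ∎
      where
      open ≡-Reasoning
      u = Inverse.from glue (B₂.from (fzero , v) , in₂ v)

    π⁻¹∘π : ∀ w → π⁻¹ (π w) ≡ w
    π⁻¹∘π w = begin
      B₁.label (proj₁ (Inverse.from glue (B₂.from (fzero , π w) , in₂ (π w))))
        ≡⟨ cong (B₁.label ∘ proj₁ ∘ Inverse.from glue) (in-≡ (B₂.from-layer-label (proj₂ v)) _ (proj₂ v)) ⟩
      B₁.label (proj₁ (Inverse.from glue v))  ≡⟨ cong (B₁.label ∘ proj₁) (Inverse.strictlyInverseʳ glue _) ⟩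
      B₁.label (B₁.from (clamp D D , w))      ≡⟨ B₁.label-from _ w ⟩
      w                                       ∎
      where
      open ≡-Reasoning
      v = Inverse.to glue (B₁.from (clamp D D , w) , out₁ w)

    node₁ : ℕ → Bits D → GNode
    node₁ k w = inj₁ (B₁.from (clamp D k , w))

    -- Layers of G₂ are counted from 1 here: its layer 0 consists of glued nodes of G₁.
    node₂ : ℕ → Bits D → GNode
    node₂ j w = inj₂ (B₂.from (fsuc (clamp d' j) , w) , subst (λ l → 0 < toℕ l) (sym (B₂.layer-from _ w)) (s≤s z≤n))

    glued : {A : Set} → (ℕ → A) → (ℕ → A) → ℕ → A
    glued lo hi k with k ≤? D
    ... | yes _ = lo k
    ... | no _  = hi (k ∸ suc D)

    glued-lo : ∀ {A : Set} {lo hi : ℕ → A} {k} → k ≤ D → glued lo hi k ≡ lo k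
    glued-lo {k = k} k≤D with k ≤? D
    ... | yes _  = refl
    ... | no k≰D = contradiction k≤D k≰D

    glued-hi : ∀ {A : Set} {lo hi : ℕ → A} j → glued lo hi (D + suc j) ≡ hi j
    glued-hi {hi = hi} j with D + suc j ≤? D
    ... | yes le = contradiction le (m+1+n≰m D)
    ... | no _   = cong hi (trans (cong (_∸ suc D) (+-suc D j)) (m+n∸m≡n (suc D) j))

    node : ℕ → Bits D → GNode
    node k w = glued (λ k → node₁ k w) (λ j → node₂ j w) k

    node-G₁ : ∀ {k} w → k ≤ D → node k w ≡ node₁ k w
    node-G₁ w = glued-lo

    node-G₂ : ∀ j w → node (D + suc j) w ≡ node₂ j w
    node-G₂ j w = glued-hi j

    position : GNode → ℕ × Bits D
    position (inj₁ u)       = toℕ (Φ₁.layer u) , B₁.label u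
    position (inj₂ (v , _)) = D + toℕ (Φ₂.layer v) , B₂.label v

    data Layer : ℕ → Set where
      in-G₁ : ∀ {k} → k ≤ D → Layer k
      in-G₂ : ∀ j → j < D → Layer (D + suc j)

    layer? : ∀ k → k ≤ D + D → Layer k
    layer? k k≤2D with k ≤? D
    ... | yes k≤D = in-G₁ k≤D
    ... | no k≰D  = subst Layer k≡D+1+j (in-G₂ j (+-cancelˡ-≤ D (suc j) D (subst (_≤ D + D) (sym k≡D+1+j) k≤2D)))
      where
      j = k ∸ suc D
      k≡D+1+j : D + suc j ≡ k
      k≡D+1+j = trans (+-suc D j) (m+[n∸m]≡n (≰⇒> k≰D))

    position-node : ∀ {k} → Layer k → ∀ w → position (node k w) ≡ (k , w)
    position-node (in-G₁ {k} k≤D) w = trans (cong position (node-G₁ w k≤D))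
      (cong₂ _,_ (trans (cong toℕ (B₁.layer-from _ w)) (toℕ-clamp D k≤D)) (B₁.label-from _ w))
    position-node (in-G₂ j (s≤s j≤d')) w = trans (cong position (node-G₂ j w))
      (cong₂ _,_ (trans (cong (λ l → D + toℕ l) (B₂.layer-from _ w)) (cong (λ i → D + suc i) (toℕ-clamp d' j≤d')))
                 (B₂.label-from _ w))

    data Step : ℕ → Set where
      within-G₁ : ∀ {k} → k < D → Step k
      across    : Step D
      within-G₂ : ∀ j → suc j < D → Step (D + suc j)

    step? : ∀ {k} → k < D + D → Step k
    step? {k} k<2D with layer? k (<⇒≤ k<2D)
    ... | in-G₁ k≤D with m≤n⇒m<n∨m≡n k≤D
    ...   | inj₁ k<D  = within-G₁ k<D
    ...   | inj₂ refl = across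
    step? k<2D | in-G₂ j _ = within-G₂ j (+-cancelˡ-< D (suc j) D k<2D)

    edge-within-G₁ : ∀ {k w w'} → k < D → AgreeExcept k w w' → Edge graph (node k w) (node (suc k) w')
    edge-within-G₁ {k} {w} {w'} k<D agree = subst₂ (Edge graph) (sym (node-G₁ w (<⇒≤ k<D))) (sym (node-G₁ w' k<D))
      (B₁.edge (trans (toℕ-clamp D k<D) (cong suc (sym (toℕ-clamp D (<⇒≤ k<D)))))
               (subst (λ i → AgreeExcept i w w') (sym (toℕ-clamp D (<⇒≤ k<D))) agree))

    edge-across : ∀ {x w'} → AgreeExcept 0 (π x) w' → Edge graph (node D x) (node (suc D) w')
    edge-across {x} {w'} agree =
      subst₂ (Edge graph) (sym (node-G₁ x ≤-refl)) (sym (trans (cong (λ k → node k w') (+-comm 1 D)) (node-G₂ 0 w')))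
      (out₁ x , subst (λ v → Edge G₂ v (B₂.from (fsuc fzero , w'))) glued-input (B₂.edge refl agree))
      where
      glued-input : B₂.from (fzero , π x) ≡ glueTo (B₁.from (clamp D D , x)) (out₁ x)
      glued-input = B₂.from-layer-label (proj₂ (Inverse.to glue (B₁.from (clamp D D , x) , out₁ x)))

    edge-within-G₂ : ∀ {j w w'} → suc j < D → AgreeExcept (suc j) w w' →
                     Edge graph (node (D + suc j) w) (node (suc (D + suc j)) w')
    edge-within-G₂ {j} {w} {w'} (s≤s 1+j≤d') agree =
      subst₂ (Edge graph) (sym (node-G₂ j w)) (sym (trans (cong (λ k → node k w') (sym (+-suc D (suc j)))) (node-G₂ (suc j) w')))
      (B₂.edge (cong suc (trans (toℕ-clamp d' 1+j≤d') (cong suc (sym (toℕ-clamp d' j≤d')))))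
               (subst (λ i → AgreeExcept (suc i) w w') (sym (toℕ-clamp d' j≤d')) agree))
      where
      j≤d' = <⇒≤ 1+j≤d'

    label : GNode → Bits D
    label = proj₂ ∘ position

    node-input : ∀ {a} → IsInput a → node 0 (label a) ≡ a
    node-input {inj₁ u} a-in = trans (node-G₁ _ z≤n) (cong inj₁ (B₁.from-layer-label a-in))

    node-output : ∀ {b} → IsOutput b → node (D + D) (label b) ≡ b
    node-output {inj₁ u} (o , o₂) = contradiction (trans (sym (proj₂ (Inverse.to glue (u , o)))) o₂) λ ()
    node-output {inj₂ (v , p)} b-out =
      trans (node-G₂ d' _) (positive-≡ (B₂.from-layer-label (trans b-out (sym (cong fsuc (clamp-fromℕ d'))))))
      where
      positive-≡ : ∀ {v v'} {p p'} → v ≡ v' → _≡_ {A = GNode} (inj₂ (v , p)) (inj₂ (v' , p'))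
      positive-≡ refl = cong (λ q → inj₂ (_ , q)) (<-irrelevant _ _)

module DisjointPaths where

  open import Data.Nat using (ℕ; suc; _+_; _∸_; _^_; _≤_; z≤n; s≤s; s≤s⁻¹)
  open import Data.Nat.Properties
  open import Data.Bool using (Bool; true)
  open import Data.List using (List; map; applyUpTo; length; concat; concatMap)
  open import Data.List.Properties using (length-map)
  open import Data.List.Relation.Unary.All as All using (All)
  open import Data.List.Relation.Unary.Any.Properties using (mapWith∈⁺; mapWith∈⁻)
  open import Data.List.Relation.Binary.Permutation.Propositional using (_↭_; ↭-reflexive)
  open import Data.List.Relation.Binary.BagAndSetEquality using (_∼[_]_; set; ∼bag⇒↭)
  open import Data.List.Membership.Propositional.Properties.WithK using (unique∧set⇒bag)
  open import Function.Bundles using (mk⇔)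
  open import Data.List.Membership.Propositional using (_∈_; mapWith∈)
  open import Data.List.Membership.Propositional.Properties
    using (∈-applyUpTo⁻; ∈-applyUpTo⁺; ∈-map⁺; ∈-map⁻; map-mapWith∈; mapWith∈-cong; mapWith∈-id; mapWith∈≗map)
  open import Data.List.Relation.Unary.Unique.Propositional using (Unique)
  open import Data.List.Relation.Unary.Unique.Propositional.Properties using (applyUpTo⁺₁)
  open import Data.Product using (Σ; ∃-syntax; _×_; _,_; proj₁; proj₂)
  import Data.Product as Product
  open import Function using (_∘_)
  open import Relation.Binary.PropositionalEquality
  open Cube
  open SingleButterfly
  open Transversals
  open Glued
  open Lists

  module Construction {d'} (P : PairOfButterflies (suc d')) {m} (m≤D : m ≤ suc d') where
    open PairOfButterflies P
    open Layout P

    -- Read backwards from its outputs and in reversed coordinates, G₂ is a standard butterfly; τ gives the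
    -- label, in these coordinates, of the input of G₂ glued to a given output of G₁.
    τ τ⁻¹ : Bits D → Bits D
    τ   = rev ∘ π
    τ⁻¹ = π⁻¹ ∘ rev

    τ∘τ⁻¹ : ∀ v → τ (τ⁻¹ v) ≡ v
    τ∘τ⁻¹ v = trans (cong rev (π∘π⁻¹ (rev v))) (rev-involutive v)

    τ⁻¹∘τ : ∀ w → τ⁻¹ (τ w) ≡ w
    τ⁻¹∘τ w = trans (cong π⁻¹ (rev-involutive (π w))) (π⁻¹∘π w)

    τ-injective : ∀ {w w'} → τ w ≡ τ w' → w ≡ w'
    τ-injective {w} {w'} eq = trans (sym (τ⁻¹∘τ w)) (trans (cong τ⁻¹ eq) (τ⁻¹∘τ w'))

    -- Kept opaque: unfolding these constructions during type checking is prohibitively expensive.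
    opaque
      transversal : CommonTransversal τ τ⁻¹ τ∘τ⁻¹ τ⁻¹∘τ m
      transversal = descend τ τ⁻¹ τ∘τ⁻¹ τ⁻¹∘τ (D ∸ m) (m+[n∸m]≡n m≤D)

    open CommonTransversal transversal

    pick₂ : Bits m → Bits D
    pick₂ = τ ∘ pick ∘ back

    Image-pick₂-τ : ∀ {x} → Image pick₂ (τ x) → Image pick x
    Image-pick₂-τ (q , eq) = back q , τ-injective eq

    Image-pick-τ : ∀ {x} → Image pick x → Image pick₂ (τ x)
    Image-pick-τ (p , refl) = prefix m (τ (pick p)) , cong (τ ∘ pick) (back-inverse p)

    module Routes (χ₁ χ₂ : Bits D → Bool) (#χ₁ : count χ₁ + 2 ^ m ≡ 2 ^ D) (#χ₂ : count χ₂ + 2 ^ m ≡ 2 ^ D) where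

      opaque
        routing₁ : Routing χ₁ (Image pick)
        routing₁ = transversal-routing m≤D χ₁ #χ₁ pick pick-transversal

        routing₂ : Routing χ₂ (Image pick₂)
        routing₂ = transversal-routing m≤D χ₂ #χ₂ pick₂ back-transversal

      module R₁ = Routing routing₁
      module R₂ = Routing routing₂

      Matched : Bits D → Bits D → Set
      Matched α s = R₂.target s ≡ τ (R₁.target α)

      partner : ∀ {α} → χ₁ α ≡ true → ∃[ s ] χ₂ s ≡ true × Matched α s
      partner χα = R₂.onto (R₁.avoids χα ∘ Image-pick₂-τ)

      module Path (α s : Bits D) (matched : Matched α s) where

        -- The label at layer k of the pair: the butterfly path in G₁ from α to its target, followed by
        -- the reversed butterfly path in G₂ from the input glued to that target to the output rev s.
        labelAt : ℕ → Bits D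
        labelAt = glued (λ k → splice k (R₁.target α) α) (λ j → rev (splice (D ∸ suc j) (R₂.target s) s))

        ψ : ℕ → GNode
        ψ k = node k (labelAt k)

        labelAt-G₁ : ∀ {k} → k ≤ D → labelAt k ≡ splice k (R₁.target α) α
        labelAt-G₁ = glued-lo

        labelAt-G₂ : ∀ j → labelAt (D + suc j) ≡ rev (splice (D ∸ suc j) (R₂.target s) s)
        labelAt-G₂ = glued-hi

        labelAt-suc-G₂ : ∀ j → labelAt (suc (D + j)) ≡ rev (splice (D ∸ suc j) (R₂.target s) s)
        labelAt-suc-G₂ j = trans (cong labelAt (sym (+-suc D j))) (labelAt-G₂ j)

        π-target : π (R₁.target α) ≡ rev (splice D (R₂.target s) s)
        π-target = begin
          π (R₁.target α)                ≡⟨ sym (rev-involutive (π (R₁.target α))) ⟩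
          rev (τ (R₁.target α))          ≡⟨ cong rev (sym matched) ⟩
          rev (R₂.target s)              ≡⟨ cong rev (sym (splice-all (R₂.target s) s)) ⟩
          rev (splice D (R₂.target s) s) ∎
          where open ≡-Reasoning

        edge-at : ∀ {k} → Step k → Edge graph (ψ k) (ψ (suc k))
        edge-at {k} (within-G₁ k<D) =
          subst₂ (λ w w' → Edge graph (node k w) (node (suc k) w')) (sym (labelAt-G₁ (<⇒≤ k<D))) (sym (labelAt-G₁ k<D))
            (edge-within-G₁ k<D (splice-step k (R₁.target α) α))
        edge-at across = subst₂ (λ w w' → Edge graph (node D w) (node (suc D) w')) labelAt-D labelAt-1+D (edge-across agree)
          where
          labelAt-D : R₁.target α ≡ labelAt D
          labelAt-D = sym (trans (labelAt-G₁ ≤-refl) (splice-all (R₁.target α) α))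
          labelAt-1+D : rev (splice (D ∸ 1) (R₂.target s) s) ≡ labelAt (suc D)
          labelAt-1+D = sym (trans (cong labelAt (+-comm 1 D)) (labelAt-G₂ 0))
          agree : AgreeExcept 0 (π (R₁.target α)) (rev (splice (D ∸ 1) (R₂.target s) s))
          agree = subst (λ w → AgreeExcept 0 w (rev (splice (D ∸ 1) (R₂.target s) s))) (sym π-target)
                    (rev-splice-step 0 (R₂.target s) s (s≤s z≤n))
        edge-at (within-G₂ j 1+j<D) =
          subst₂ (λ w w' → Edge graph (node (D + suc j) w) (node (suc (D + suc j)) w'))
            (sym (labelAt-G₂ j)) (sym (labelAt-suc-G₂ (suc j)))
            (edge-within-G₂ 1+j<D (rev-splice-step (suc j) (R₂.target s) s 1+j<D))

        path : AnyWalk graph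
        path = ψ 0 , ψ (D + D) , chain {graph} ψ (D + D) (λ k k<2D → edge-at (step? k<2D))

        nodes-path : nodesOf path ≡ applyUpTo ψ (suc (D + D))
        nodes-path = walkNodes-chain {graph} ψ (D + D) (λ k k<2D → edge-at (step? k<2D))

        position-ψ : ∀ {k} → k ≤ D + D → position (ψ k) ≡ (k , labelAt k)
        position-ψ {k} k≤2D = position-node (layer? k k≤2D) (labelAt k)

        ∈-path : ∀ {z} → z ∈ nodesOf path → ∃[ k ] k ≤ D + D × z ≡ ψ k
        ∈-path {z} z∈ = Product.map₂ (Product.map₁ s≤s⁻¹) (∈-applyUpTo⁻ ψ (subst (z ∈_) nodes-path z∈))

        unique-path : Unique (nodesOf path)
        unique-path = subst Unique (sym nodes-path) (applyUpTo⁺₁ ψ (suc (D + D)) λ {i} {j} i<j j<1+2D eq →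
          <⇒≢ i<j (cong proj₁ (trans (sym (position-ψ (<⇒≤ (<-≤-trans i<j (s≤s⁻¹ j<1+2D)))))
                              (trans (cong position eq) (position-ψ (s≤s⁻¹ j<1+2D))))))

        start-path : start path ≡ node 0 α
        start-path = cong (node 0) (labelAt-G₁ z≤n)

        end-path : end path ≡ node (D + D) (rev s)
        end-path = cong (node (D + D)) (trans (labelAt-G₂ d') (cong (λ i → rev (splice i (R₂.target s) s)) (n∸n≡0 D)))

        end∈path : end path ∈ nodesOf path
        end∈path = subst (end path ∈_) (sym nodes-path) (∈-applyUpTo⁺ ψ (n<1+n (D + D)))

      record Pairing : Set where
        field
          input    : Bits D
          output   : Bits D
          input∈   : χ₁ input ≡ true
          output∈  : χ₂ output ≡ true
          matched  : Matched input output

        open Path input output matched public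

      labels-determine : ∀ (p p' : Pairing) {k} → Layer k → Pairing.labelAt p k ≡ Pairing.labelAt p' k →
                         Pairing.input p ≡ Pairing.input p'
      labels-determine p p' (in-G₁ {k} k≤D) eq =
        R₁.disjoint k (P.input∈) (P'.input∈) (trans (sym (P.labelAt-G₁ k≤D)) (trans eq (P'.labelAt-G₁ k≤D)))
        where
        module P = Pairing p
        module P' = Pairing p'
      labels-determine p p' (in-G₂ j _) eq =
        R₁.disjoint D P.input∈ P'.input∈ (trans (splice-all _ P.input) (trans same-target (sym (splice-all _ P'.input))))
        where
        module P = Pairing p
        module P' = Pairing p'
        same-output : P.output ≡ P'.output
        same-output = R₂.disjoint (D ∸ suc j) P.output∈ P'.output∈
          (rev-injective (trans (sym (P.labelAt-G₂ j)) (trans eq (P'.labelAt-G₂ j))))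
        same-target : R₁.target P.input ≡ R₁.target P'.input
        same-target = τ-injective (trans (sym P.matched) (trans (cong R₂.target same-output) P'.matched))

      paths-meet : ∀ (p p' : Pairing) {z} → z ∈ nodesOf (Pairing.path p) → z ∈ nodesOf (Pairing.path p') →
                   Pairing.input p ≡ Pairing.input p'
      paths-meet p p' z∈ z∈' = labels-determine p p' (layer? k k≤2D)
        (trans (cong proj₂ positions) (cong P'.labelAt (sym (cong proj₁ positions))))
        where
        module P = Pairing p
        module P' = Pairing p'
        k = proj₁ (P.∈-path z∈)
        k≤2D = proj₁ (proj₂ (P.∈-path z∈))
        k' = proj₁ (P'.∈-path z∈')
        k'≤2D = proj₁ (proj₂ (P'.∈-path z∈'))
        positions : (k , P.labelAt k) ≡ (k' , P'.labelAt k')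
        positions = trans (sym (P.position-ψ k≤2D))
          (trans (cong position (trans (sym (proj₂ (proj₂ (P.∈-path z∈)))) (proj₂ (proj₂ (P'.∈-path z∈')))))
                 (P'.position-ψ k'≤2D))

    module Assemble (A B : List GNode) (unique-A : Unique A) (unique-B : Unique B)
                    (inputs : All IsInput A) (outputs : All IsOutput B)
                    (|A| : length A ≡ 2 ^ D ∸ 2 ^ m) (|B| : length B ≡ 2 ^ D ∸ 2 ^ m) where

      label-injectiveᴬ : ∀ {a a'} → a ∈ A → a' ∈ A → label a ≡ label a' → a ≡ a'
      label-injectiveᴬ a∈ a'∈ eq =
        trans (sym (node-input (All.lookup inputs a∈))) (trans (cong (node 0) eq) (node-input (All.lookup inputs a'∈)))

      label-injectiveᴮ : ∀ {b b'} → b ∈ B → b' ∈ B → rev (label b) ≡ rev (label b') → b ≡ b'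
      label-injectiveᴮ b∈ b'∈ eq = trans (sym (node-output (All.lookup outputs b∈)))
        (trans (cong (node (D + D)) (rev-injective eq)) (node-output (All.lookup outputs b'∈)))

      labelsᴬ labelsᴮ : List (Bits D)
      labelsᴬ = map label A
      labelsᴮ = map (rev ∘ label) B

      count-labels : ∀ {X : List GNode} (f : GNode → Bits D) → Unique X →
                     (∀ {x x'} → x ∈ X → x' ∈ X → f x ≡ f x' → x ≡ x') → length X ≡ 2 ^ D ∸ 2 ^ m →
                     count (_∈ᴮ map f X) + 2 ^ m ≡ 2 ^ D
      count-labels {X} f unique-X injective |X| = begin
        count (_∈ᴮ map f X) + 2 ^ m  ≡⟨ cong (_+ 2 ^ m) (count-∈ᴮ unique-map) ⟩
        length (map f X) + 2 ^ m     ≡⟨ cong (_+ 2 ^ m) (trans (length-map f X) |X|) ⟩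
        2 ^ D ∸ 2 ^ m + 2 ^ m        ≡⟨ m∸n+n≡m (^-monoʳ-≤ 2 m≤D) ⟩
        2 ^ D                        ∎
        where
        open ≡-Reasoning
        unique-map : Unique (map f X)
        unique-map = subst Unique (mapWith∈≗map f X) (unique-mapWith∈ X (λ {x} _ → f x) unique-X injective)

      open Routes (_∈ᴮ labelsᴬ) (_∈ᴮ labelsᴮ) (count-labels label unique-A label-injectiveᴬ |A|)
                  (count-labels (rev ∘ label) unique-B label-injectiveᴮ |B|)

      pairing : ∀ {a} → a ∈ A → Pairing
      pairing {a} a∈ = record
        { input   = label a
        ; output  = proj₁ matching
        ; input∈  = ∈⇒∈ᴮ (∈-map⁺ label a∈)
        ; output∈ = proj₁ (proj₂ matching)
        ; matched = proj₂ (proj₂ matching)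
        }
        where matching = partner (∈⇒∈ᴮ (∈-map⁺ label a∈))

      route : ∀ {a} → a ∈ A → AnyWalk graph
      route = Pairing.path ∘ pairing

      routes : List (AnyWalk graph)
      routes = mapWith∈ A route

      starts : map start routes ↭ A
      starts = ↭-reflexive (begin
        map start (mapWith∈ A route)        ≡⟨ map-mapWith∈ A route start ⟩
        mapWith∈ A (start ∘ route)          ≡⟨ mapWith∈-cong A (start ∘ route) (λ {a} _ → a) start-route ⟩
        mapWith∈ A (λ {a} _ → a)            ≡⟨ mapWith∈-id A ⟩
        A                                   ∎)
        where
        open ≡-Reasoning
        start-route : ∀ {a} (a∈ : a ∈ A) → start (route a∈) ≡ a
        start-route a∈ = trans (Pairing.start-path (pairing a∈)) (node-input (All.lookup inputs a∈))

      end-route : ∀ {a} (a∈ : a ∈ A) → end (route a∈) ≡ node (D + D) (rev (Pairing.output (pairing a∈)))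
      end-route a∈ = Pairing.end-path (pairing a∈)

      ends-in-B : ∀ {a} (a∈ : a ∈ A) → end (route a∈) ∈ B
      ends-in-B a∈ = reached (∈-map⁻ (rev ∘ label) (∈ᴮ⇒∈ (Pairing.output∈ (pairing a∈))))
        where
        open ≡-Reasoning
        reached : ∃[ b ] b ∈ B × Pairing.output (pairing a∈) ≡ rev (label b) → end (route a∈) ∈ B
        reached (b , b∈ , output≡) = subst (_∈ B) (sym (begin
          end (route a∈)                                   ≡⟨ end-route a∈ ⟩
          node (D + D) (rev (Pairing.output (pairing a∈))) ≡⟨ cong (node (D + D) ∘ rev) output≡ ⟩
          node (D + D) (rev (rev (label b)))               ≡⟨ cong (node (D + D)) (rev-involutive (label b)) ⟩
          node (D + D) (label b)                           ≡⟨ node-output (All.lookup outputs b∈) ⟩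
          b                                                ∎)) b∈

      B-reached : ∀ {b} → b ∈ B → b ∈ map end routes
      B-reached {b} b∈ = subst (b ∈_) (sym (map-mapWith∈ A route end)) (mapWith∈⁺ (end ∘ route) (a , a∈ , sym end≡b))
        where
        s₀ = rev (label b)
        s₀∈ : s₀ ∈ᴮ labelsᴮ ≡ true
        s₀∈ = ∈⇒∈ᴮ (∈-map⁺ (rev ∘ label) b∈)
        x₀ = τ⁻¹ (R₂.target s₀)
        source = R₁.onto {x₀} λ image → R₂.avoids s₀∈ (subst (Image pick₂) (τ∘τ⁻¹ _) (Image-pick-τ image))
        α = proj₁ source
        α∈ = ∈-map⁻ label (∈ᴮ⇒∈ (proj₁ (proj₂ source)))
        a = proj₁ α∈
        a∈ = proj₁ (proj₂ α∈)
        module P = Pairing (pairing a∈)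
        output≡s₀ : P.output ≡ s₀
        output≡s₀ = R₂.disjoint D P.output∈ s₀∈ (begin
          splice D (R₂.target P.output) P.output ≡⟨ splice-all _ P.output ⟩
          R₂.target P.output                     ≡⟨ P.matched ⟩
          τ (R₁.target (label a))                ≡⟨ cong (τ ∘ R₁.target) (sym (proj₂ (proj₂ α∈))) ⟩
          τ (R₁.target α)                        ≡⟨ cong τ (proj₂ (proj₂ source)) ⟩
          τ x₀                                   ≡⟨ τ∘τ⁻¹ _ ⟩
          R₂.target s₀                           ≡⟨ sym (splice-all _ s₀) ⟩
          splice D (R₂.target s₀) s₀             ∎)
          where open ≡-Reasoning
        end≡b : end (route a∈) ≡ b
        end≡b = trans (end-route a∈) (trans (cong (node (D + D)) (trans (cong rev output≡s₀) (rev-involutive (label b))))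
                                            (node-output (All.lookup outputs b∈)))

      routes-meet : ∀ {a a' z} (a∈ : a ∈ A) (a'∈ : a' ∈ A) → z ∈ nodesOf (route a∈) → z ∈ nodesOf (route a'∈) → a ≡ a'
      routes-meet a∈ a'∈ z∈ z∈' = label-injectiveᴬ a∈ a'∈ (paths-meet (pairing a∈) (pairing a'∈) z∈ z∈')

      unique-ends : Unique (map end routes)
      unique-ends = subst Unique (sym (map-mapWith∈ A route end))
        (unique-mapWith∈ A (end ∘ route) unique-A λ a∈ a'∈ eq →
          routes-meet a∈ a'∈ (Pairing.end∈path (pairing a∈))
            (subst (_∈ nodesOf (route a'∈)) (sym eq) (Pairing.end∈path (pairing a'∈))))

      ends⊆B : ∀ {b} → b ∈ map end routes → b ∈ B
      ends⊆B {b} b∈ = from-source (mapWith∈⁻ A (end ∘ route) (subst (b ∈_) (map-mapWith∈ A route end) b∈))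
        where
        from-source : ∃[ a ] Σ (a ∈ A) (λ a∈ → b ≡ end (route a∈)) → b ∈ B
        from-source (a , a∈ , b≡) = subst (_∈ B) (sym b≡) (ends-in-B a∈)

      ends : map end routes ↭ B
      ends = ∼bag⇒↭ (unique∧set⇒bag unique-ends unique-B same-elements)
        where
        same-elements : map end routes ∼[ set ] B
        same-elements = mk⇔ ends⊆B B-reached

      routes-unique : All (Unique ∘ nodesOf) routes
      routes-unique = all-mapWith∈ A route (Pairing.unique-path ∘ pairing)

      routes-disjoint : Unique (concatMap nodesOf routes)
      routes-disjoint = subst Unique (cong concat (sym (map-mapWith∈ A route nodesOf)))
        (unique-concat-mapWith∈ A (nodesOf ∘ route) unique-A (Pairing.unique-path ∘ pairing) routes-meet)

corollary1 : (d m : ℕ) → m ≤ d → (P : PairOfButterflies d) →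
  (A B : List (PairOfButterflies.GNode P)) →
  Unique A → Unique B →
  All (PairOfButterflies.IsInput P) A → All (PairOfButterflies.IsOutput P) B →
  length A ≡ 2 ^ d ∸ 2 ^ m → length B ≡ 2 ^ d ∸ 2 ^ m →
  Σ (List (AnyWalk (PairOfButterflies.graph P))) (λ ps →
    (map start ps ↭ A) × (map end ps ↭ B) ×
    All (λ p → Unique (nodesOf p)) ps × Unique (concatMap nodesOf ps))
corollary1 zero    zero z≤n P [] [] _ _ _ _ _ _ = [] , ↭-refl , ↭-refl , [] , []
corollary1 (suc d) m m≤d P A B unique-A unique-B inputs outputs |A| |B| =
  routes , starts , ends , routes-unique , routes-disjoint
  where
  open DisjointPaths.Construction P m≤d
  open Assemble A B unique-A unique-B inputs outputs |A| |B|
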